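{- With $T(3,n)=\dfrac{60\,(2n)!}{n!\,(n+3)!}$, $$1+\sum_{n=0}^{\infty}T(3,n+1)\,x^n=\sqrt{x}\sum_{k=6}^{\infty}H_k^{(4)}H_{k-2}^{(3)}H_{k-4}^{(2)}+2G_1+2G_2+G_3+G_5.$$
   Context: Paths use steps $(1,1)$ and $(1,-1)$; the level of a point is its $y$-coordinate. A ballot path is a path starting at $(0,0)$ that never goes below level $0$; its height is the maximum level it reaches. A path with $n$ steps is given weight $x^{n/2}$. Let $G_k^{(j)}$ be the sum of the weights of all ballot paths of height at most $k$ ending at level $j$, and $H_k^{(j)}=G_k^{(j)}-G_{k-1}^{(j)}$ the sum of the weights of ballot paths of height exactly $k$ ending at level $j$. Let $G_k=G_k^{(0)}$, the generating function (weight $x^{\text{semilength}}$) of Dyck paths (ballot paths ending at level $0$) of height at most $k$. -}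

module Defs where

open import Data.Bool using (Bool; true; false; if_then_else_)
open import Data.Nat using (ℕ; zero; suc; _+_; _*_; _∸_)
open import Data.Integer as ℤ using (ℤ; +_; 0ℤ; 1ℤ)
open import Data.List using (List; []; _∷_; map; _++_; length; filter)
open import Data.List.Relation.Unary.All using (All; all?)
open import Data.List.Relation.Unary.Any using (Any; any?)
open import Data.Product using (_×_)
open import Relation.Binary.PropositionalEquality using (_≡_)
open import Relation.Nullary using (Dec)
open import Relation.Nullary.Decidable using (_×-dec_)

-- A path is a list of steps: true = (1,1) (up), false = (1,-1) (down).
Path : Set
Path = List Bool

step : ℤ → Bool → ℤ
step z true  = z ℤ.+ 1ℤ
step z false = z ℤ.- 1ℤ

levels : ℤ → Path → List ℤ
levels z []       = z ∷ []
levels z (b ∷ bs) = z ∷ levels (step z b) bs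

endLevel : ℤ → Path → ℤ
endLevel z []       = z
endLevel z (b ∷ bs) = endLevel (step z b) bs

paths : ℕ → List Path
paths zero    = [] ∷ []
paths (suc n) = map (true ∷_) (paths n) ++ map (false ∷_) (paths n)

BallotLe : ℕ → ℕ → Path → Set
BallotLe k j p = All (λ y → (0ℤ ℤ.≤ y) × (y ℤ.≤ + k)) (levels 0ℤ p) × (endLevel 0ℤ p ≡ + j)

BallotEq : ℕ → ℕ → Path → Set
BallotEq k j p = BallotLe k j p × Any (λ y → y ≡ + k) (levels 0ℤ p)

ballotLe? : ∀ k j p → Dec (BallotLe k j p)
ballotLe? k j p =
  all? (λ y → (0ℤ ℤ.≤? y) ×-dec (y ℤ.≤? + k)) (levels 0ℤ p) ×-dec (endLevel 0ℤ p ℤ.≟ + j)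

ballotEq? : ∀ k j p → Dec (BallotEq k j p)
ballotEq? k j p = ballotLe? k j p ×-dec any? (λ y → y ℤ.≟ + k) (levels 0ℤ p)

-- Gc k j n : coefficient of the weight x^(n/2) in G_k^(j),
--   i.e. the number of ballot paths with n steps, height ≤ k, ending at level j.
Gc : ℕ → ℕ → ℕ → ℕ
Gc k j n = length (filter (ballotLe? k j) (paths n))

-- Hc k j n : number of ballot paths with n steps, height exactly k, ending at j
--   (coefficient of x^(n/2) in H_k^(j)).
Hc : ℕ → ℕ → ℕ → ℕ
Hc k j n = length (filter (ballotEq? k j) (paths n))

sumTo : ℕ → (ℕ → ℕ) → ℕ
sumTo zero    f = f zero
sumTo (suc n) f = sumTo n f + f (suc n)

-- coefficient of t^m (t = sqrt x, exponent = number of steps) in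
-- H_k^(4) H_{k-2}^(3) H_{k-4}^(2)
prodCoeff : ℕ → ℕ → ℕ
prodCoeff k m =
  sumTo m (λ a → sumTo (m ∸ a) (λ b →
    Hc k 4 a * Hc (k ∸ 2) 3 b * Hc (k ∸ 4) 2 (m ∸ a ∸ b)))

-- coefficient of t^m in Σ_{k≥6} H_k^(4) H_{k-2}^(3) H_{k-4}^(2);
-- terms with k > m vanish (a path of height k has at least k steps),
-- so the sum over k = 6 .. 6+m is the full (finite) sum.
sumCoeff : ℕ → ℕ
sumCoeff m = sumTo m (λ i → prodCoeff (6 + i) m)

-- coefficient of x^N in the right-hand side
--   sqrt(x) Σ_{k≥6} H_k^(4) H_{k-2}^(3) H_{k-4}^(2) + 2G_1 + 2G_2 + G_3 + G_5
rhsCoeff : ℕ → ℕ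
rhsCoeff zero    = 2 * Gc 1 0 0 + 2 * Gc 2 0 0 + Gc 3 0 0 + Gc 5 0 0
rhsCoeff (suc N) = sumCoeff (2 * N + 1)
  + (2 * Gc 1 0 (2 * suc N) + 2 * Gc 2 0 (2 * suc N) + Gc 3 0 (2 * suc N) + Gc 5 0 (2 * suc N))

δ0 : ℕ → ℕ
δ0 zero    = 1
δ0 (suc _) = 0

module Submission where

-- Transfer matrices: with the Fibonacci-type polynomials F₀ = 0, F₁ = 1,
-- F_{k+2} = F_{k+1} - x F_k, the last-step recurrences of bounded paths give
-- F_{k+2} G_k^(j) = t^j F_{k+1-j} (t = √x), hence F_{k+2} F_{k+3} H_{k+1}^(j) = t^j x^{k+1-j} F_{j+1}.
-- Writing x = q/(1+q)², i.e. q = C - 1 for the Catalan series C (x C² = C - 1), turns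
-- F_{m+1} into (1 - q^{m+1}) / ((1 - q)(1 + q)^m), so every summand and every G_k becomes
-- rational in q. The summands then telescope: the tail from the i-th summand on is
-- K R(q^i) / D_i for explicit polynomials K, R, D_i, and it vanishes to order i + 1.
-- At i = 0 this identifies the right-hand side with 1 + 10C² - 6C³ + C⁴, whose coefficient
-- of x^n is 16 c_{n+1} - 8 c_{n+2} + c_{n+3} = T(3, n+1) by the Catalan recurrence.

open import Defs
open import Algebra.Bundles using (CommutativeRing)
open import Level using (Level)

module PowerSeries where

  import Algebra.Construct.Pointwise as Pointwise
  import Algebra.Solver.Ring
  import Algebra.Solver.Ring.AlmostCommutativeRing as ACR
  open import Data.Integer using (ℤ; 0ℤ; 1ℤ; _+_; _*_; -_; _≟_; +-*-rawRing)
  import Data.Integer.Properties as ℤ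
  open import Algebra.Properties.CommutativeSemigroup ℤ.+-commutativeSemigroup using (interchange)
  open import Data.Maybe using (Maybe; just; nothing)
  open import Data.Nat as ℕ using (ℕ; zero; suc; _<_; z<s; s<s)
  import Data.Nat.Properties as ℕ
  open import Data.Product using (_,_)
  open import Data.Sum using (inj₁; inj₂)
  open import Relation.Binary.PropositionalEquality
  open import Relation.Binary.Bundles using (Setoid)
  open import Relation.Nullary using (yes; no)

  -- Formal power series over ℤ in t = √x: a path with n steps has weight tⁿ.
  Series : Set
  Series = ℕ → ℤ

  infix 4 _≈_
  _≈_ : Series → Series → Set
  a ≈ b = ∀ n → a n ≡ b n

  infixl 6 _⊕_
  _⊕_ : Series → Series → Series
  (a ⊕ b) n = a n + b n

  infix 8 ⊝_
  ⊝_ : Series → Series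
  (⊝ a) n = - a n

  0S : Series
  0S _ = 0ℤ

  const : ℤ → Series
  const c zero    = c
  const c (suc _) = 0ℤ

  1S : Series
  1S = const 1ℤ

  tail : Series → Series
  tail a n = a (suc n)

  infixl 7 _⊛_
  _⊛_ : Series → Series → Series
  (a ⊛ b) zero    = a 0 * b 0
  (a ⊛ b) (suc n) = a 0 * b (suc n) + (tail a ⊛ b) n

  scale : ℤ → Series → Series
  scale c a n = c * a n

  ≈-setoid : Setoid _ _
  ≈-setoid = record { isEquivalence = Pointwise.isEquivalence ℕ {_≈_ = _≡_ {A = ℤ}} isEquivalence }

  open Setoid ≈-setoid public using () renaming (refl to ≈-refl; reflexive to ≈-reflexive; sym to ≈-sym; trans to ≈-trans)
  open ≡-Reasoning

  ⊛-cong : ∀ {a a′ b b′} → a ≈ a′ → b ≈ b′ → a ⊛ b ≈ a′ ⊛ b′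
  ⊛-cong p q zero    = cong₂ _*_ (p 0) (q 0)
  ⊛-cong p q (suc n) = cong₂ _+_ (cong₂ _*_ (p 0) (q (suc n))) (⊛-cong (λ i → p (suc i)) q n)

  ⊛-annihilˡ : ∀ {a} b → a ≈ 0S → a ⊛ b ≈ 0S
  ⊛-annihilˡ b a≈0 zero    = cong (_* b 0) (a≈0 0)
  ⊛-annihilˡ b a≈0 (suc n) =
    cong₂ _+_ (cong (_* b (suc n)) (a≈0 0)) (⊛-annihilˡ b (λ i → a≈0 (suc i)) n)

  ⊛-identityˡ : ∀ a → 1S ⊛ a ≈ a
  ⊛-identityˡ a zero    = ℤ.*-identityˡ (a 0)
  ⊛-identityˡ a (suc n) = trans
    (cong₂ _+_ (ℤ.*-identityˡ (a (suc n))) (⊛-annihilˡ a (λ _ → refl) n))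
    (ℤ.+-identityʳ (a (suc n)))

  ⊛-distribʳ : ∀ a b c → (a ⊕ b) ⊛ c ≈ a ⊛ c ⊕ b ⊛ c
  ⊛-distribʳ a b c zero    = ℤ.*-distribʳ-+ (c 0) (a 0) (b 0)
  ⊛-distribʳ a b c (suc n) = trans
    (cong₂ _+_ (ℤ.*-distribʳ-+ (c (suc n)) (a 0) (b 0)) (⊛-distribʳ (tail a) (tail b) c n))
    (interchange (a 0 * c (suc n)) (b 0 * c (suc n)) ((tail a ⊛ c) n) ((tail b ⊛ c) n))

  ⊛-scaleˡ : ∀ s a b → scale s a ⊛ b ≈ scale s (a ⊛ b)
  ⊛-scaleˡ s a b zero    = ℤ.*-assoc s (a 0) (b 0)
  ⊛-scaleˡ s a b (suc n) = trans
    (cong₂ _+_ (ℤ.*-assoc s (a 0) (b (suc n))) (⊛-scaleˡ s (tail a) b n))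
    (sym (ℤ.*-distribˡ-+ s (a 0 * b (suc n)) ((tail a ⊛ b) n)))

  ⊛-suc-last : ∀ a b n → (a ⊛ b) (suc n) ≡ (a ⊛ tail b) n + a (suc n) * b 0
  ⊛-suc-last a b zero    = refl
  ⊛-suc-last a b (suc n) = trans
    (cong (a 0 * b (suc (suc n)) +_) (⊛-suc-last (tail a) b n))
    (sym (ℤ.+-assoc (a 0 * b (suc (suc n))) ((tail a ⊛ tail b) n) (a (suc (suc n)) * b 0)))

  ⊛-comm : ∀ a b → a ⊛ b ≈ b ⊛ a
  ⊛-comm a b zero    = ℤ.*-comm (a 0) (b 0)
  ⊛-comm a b (suc n) = begin
    a 0 * b (suc n) + (tail a ⊛ b) n ≡⟨ cong₂ _+_ (ℤ.*-comm (a 0) (b (suc n))) (⊛-comm (tail a) b n) ⟩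
    b (suc n) * a 0 + (b ⊛ tail a) n ≡⟨ ℤ.+-comm (b (suc n) * a 0) ((b ⊛ tail a) n) ⟩
    (b ⊛ tail a) n + b (suc n) * a 0 ≡⟨ ⊛-suc-last b a n ⟨
    (b ⊛ a) (suc n)                  ∎

  ⊛-assoc : ∀ a b c → (a ⊛ b) ⊛ c ≈ a ⊛ (b ⊛ c)
  ⊛-assoc a b c zero    = ℤ.*-assoc (a 0) (b 0) (c 0)
  ⊛-assoc a b c (suc n) = begin
    (a 0 * b 0) * c (suc n) + (tail (a ⊛ b) ⊛ c) n
      ≡⟨ cong₂ _+_ (ℤ.*-assoc (a 0) (b 0) (c (suc n))) (⊛-distribʳ (scale (a 0) (tail b)) (tail a ⊛ b) c n) ⟩
    a 0 * (b 0 * c (suc n)) + ((scale (a 0) (tail b) ⊛ c) n + ((tail a ⊛ b) ⊛ c) n)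
      ≡⟨ cong₂ (λ u v → a 0 * (b 0 * c (suc n)) + (u + v)) (⊛-scaleˡ (a 0) (tail b) c n) (⊛-assoc (tail a) b c n) ⟩
    a 0 * (b 0 * c (suc n)) + (a 0 * (tail b ⊛ c) n + (tail a ⊛ (b ⊛ c)) n)
      ≡⟨ ℤ.+-assoc (a 0 * (b 0 * c (suc n))) (a 0 * (tail b ⊛ c) n) ((tail a ⊛ (b ⊛ c)) n) ⟨
    a 0 * (b 0 * c (suc n)) + a 0 * (tail b ⊛ c) n + (tail a ⊛ (b ⊛ c)) n
      ≡⟨ cong (_+ (tail a ⊛ (b ⊛ c)) n) (ℤ.*-distribˡ-+ (a 0) (b 0 * c (suc n)) ((tail b ⊛ c) n)) ⟨
    a 0 * (b ⊛ c) (suc n) + (tail a ⊛ (b ⊛ c)) n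
      ∎

  seriesRing : CommutativeRing _ _
  seriesRing = record
    { Carrier = Series ; _≈_ = _≈_ ; _+_ = _⊕_ ; _*_ = _⊛_ ; -_ = ⊝_ ; 0# = 0S ; 1# = 1S
    ; isCommutativeRing = record
      { isRing = record
        { +-isAbelianGroup = Pointwise.isAbelianGroup ℕ {_≈_ = _≡_ {A = ℤ}} ℤ.+-0-isAbelianGroup
        ; *-cong           = ⊛-cong
        ; *-assoc          = ⊛-assoc
        ; *-identity       = ⊛-identityˡ , λ a → ≈-trans (⊛-comm a 1S) (⊛-identityˡ a)
        ; distrib          = (λ a b c n → trans (⊛-comm a (b ⊕ c) n)
                                           (trans (⊛-distribʳ b c a n) (cong₂ _+_ (⊛-comm b a n) (⊛-comm c a n))))
                           , (λ a b c → ⊛-distribʳ b c a)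
        }
      ; *-comm = ⊛-comm
      }
    }

  const-⊛ : ∀ c a n → (const c ⊛ a) n ≡ c * a n
  const-⊛ c a zero    = refl
  const-⊛ c a (suc n) = trans (cong (c * a (suc n) +_) (⊛-annihilˡ a (λ _ → refl) n)) (ℤ.+-identityʳ (c * a (suc n)))

  const-* : ∀ c d → const (c * d) ≈ const c ⊛ const d
  const-* c d zero    = refl
  const-* c d (suc n) = sym (trans (const-⊛ c (const d) (suc n)) (ℤ.*-zeroʳ c))

  const-homomorphism : +-*-rawRing ACR.-Raw-AlmostCommutative⟶ ACR.fromCommutativeRing seriesRing
  const-homomorphism = record
    { ⟦_⟧    = const
    ; +-homo = λ { c d zero → refl ; c d (suc n) → refl }
    ; *-homo = const-*
    ; -‿homo = λ { c zero → refl ; c (suc n) → refl }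
    ; 0-homo = λ { zero → refl ; (suc n) → refl }
    ; 1-homo = λ _ → refl
    }

  const-≟ : ∀ c d → Maybe (const c ≈ const d)
  const-≟ c d with c ≟ d
  ... | yes refl = just (λ _ → refl)
  ... | no _     = nothing

  -- Solver constants are integers; note that con (+ 0) denotes const 0ℤ, which is not 0S definitionally.
  open Algebra.Solver.Ring +-*-rawRing (ACR.fromCommutativeRing seriesRing) const-homomorphism const-≟ public
    using (Polynomial; solve; _:+_; _:-_; _:*_; :-_; _:^_; _:=_; con)

  T : Series
  T 1 = 1ℤ
  T _ = 0ℤ

  T-⊛-suc : ∀ a n → (T ⊛ a) (suc n) ≡ a n
  T-⊛-suc a n = trans (ℤ.+-identityˡ _)
    (trans (⊛-cong {tail T} {1S} (λ { zero → refl ; (suc _) → refl }) ≈-refl n) (⊛-identityˡ a n))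

  X : Series
  X = T ⊛ T

  infixr 8 _^_
  _^_ : Series → ℕ → Series
  a ^ zero  = 1S
  a ^ suc n = a ⊛ a ^ n

  ^-+ : ∀ a m n → a ^ (m ℕ.+ n) ≈ a ^ m ⊛ a ^ n
  ^-+ a zero    n = ≈-sym (⊛-identityˡ (a ^ n))
  ^-+ a (suc m) n = ≈-trans (⊛-cong {a} ≈-refl (^-+ a m n)) (≈-sym (⊛-assoc a (a ^ m) (a ^ n)))

  infix 4 _≈[<_]_
  _≈[<_]_ : Series → ℕ → Series → Set
  a ≈[< d ] b = ∀ n → n < d → a n ≡ b n

  ≈[<]-extend : ∀ {a b} d → a ≈[< d ] b → a d ≡ b d → a ≈[< suc d ] b
  ≈[<]-extend d a≈b aₔ≡bₔ n n≤d with ℕ.m≤n⇒m<n∨m≡n (ℕ.≤-pred n≤d)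
  ... | inj₁ n<d  = a≈b n n<d
  ... | inj₂ refl = aₔ≡bₔ

  ⊛-cong-< : ∀ {a a′ b b′} d → a ≈[< d ] a′ → b ≈[< d ] b′ → a ⊛ b ≈[< d ] a′ ⊛ b′
  ⊛-cong-< (suc d) p q zero    _         = cong₂ _*_ (p 0 z<s) (q 0 z<s)
  ⊛-cong-< (suc d) p q (suc n) (s<s n<d) = cong₂ _+_
    (cong₂ _*_ (p 0 z<s) (q (suc n) (s<s n<d)))
    (⊛-cong-< d (λ i i<d → p (suc i) (s<s i<d)) (λ i i<d → q i (ℕ.m<n⇒m<1+n i<d)) n n<d)

  ⊛-orderʳ : ∀ a {b} d → b ≈[< d ] 0S → a ⊛ b ≈[< d ] 0S
  ⊛-orderʳ a d b≈0 zero    0<d = trans (cong (a 0 *_) (b≈0 0 0<d)) (ℤ.*-zeroʳ (a 0))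
  ⊛-orderʳ a d b≈0 (suc n) n<d = cong₂ _+_
    (trans (cong (a 0 *_) (b≈0 (suc n) n<d)) (ℤ.*-zeroʳ (a 0)))
    (⊛-orderʳ (tail a) d b≈0 n (ℕ.<-trans (ℕ.n<1+n n) n<d))

  ⊛-orderˡ : ∀ {a} b d → a ≈[< d ] 0S → a ⊛ b ≈[< d ] 0S
  ⊛-orderˡ {a} b d a≈0 n n<d = trans (⊛-comm a b n) (⊛-orderʳ b d a≈0 n n<d)

  ⊛-order : ∀ {a b} α β → a ≈[< α ] 0S → b ≈[< β ] 0S → a ⊛ b ≈[< α ℕ.+ β ] 0S
  ⊛-order {a} zero    β a≈0 b≈0 = ⊛-orderʳ a β b≈0
  ⊛-order {a} {b} (suc α) β a≈0 b≈0 zero    _         = cong (_* b 0) (a≈0 0 z<s)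
  ⊛-order {a} {b} (suc α) β a≈0 b≈0 (suc n) (s<s n<d) = cong₂ _+_
    (cong (_* b (suc n)) (a≈0 0 z<s))
    (⊛-order α β (λ i i<α → a≈0 (suc i) (s<s i<α)) b≈0 n n<d)

  ⊛-unit-leading : ∀ {u a} d → u 0 ≡ 1ℤ → a ≈[< d ] 0S → (u ⊛ a) d ≡ a d
  ⊛-unit-leading {u} {a} zero    u₀≡1 _   = trans (cong (_* a 0) u₀≡1) (ℤ.*-identityˡ (a 0))
  ⊛-unit-leading {u} {a} (suc d) u₀≡1 a≈0 = begin
    (u ⊛ a) (suc d)                  ≡⟨ ⊛-comm u a (suc d) ⟩
    (a ⊛ u) (suc d)                  ≡⟨ ⊛-suc-last a u d ⟩
    (a ⊛ tail u) d + a (suc d) * u 0 ≡⟨ cong₂ _+_ (⊛-orderˡ (tail u) (suc d) a≈0 d ℕ.≤-refl) (cong (a (suc d) *_) u₀≡1) ⟩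
    0ℤ + a (suc d) * 1ℤ              ≡⟨ ℤ.+-identityˡ (a (suc d) * 1ℤ) ⟩
    a (suc d) * 1ℤ                   ≡⟨ ℤ.*-identityʳ (a (suc d)) ⟩
    a (suc d)                        ∎

  unit-⊛-order : ∀ {u a} d → u 0 ≡ 1ℤ → u ⊛ a ≈[< d ] 0S → a ≈[< d ] 0S
  unit-⊛-order zero    _    _    _ ()
  unit-⊛-order (suc d) u₀≡1 ua≈0 = ≈[<]-extend d a≈0 (trans (sym (⊛-unit-leading d u₀≡1 a≈0)) (ua≈0 d ℕ.≤-refl))
    where
    a≈0 = unit-⊛-order d u₀≡1 (λ n n<d → ua≈0 n (ℕ.m<n⇒m<1+n n<d))

  unit-cancelˡ : ∀ {u a b} → u 0 ≡ 1ℤ → u ⊛ a ≈ u ⊛ b → a ≈ b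
  unit-cancelˡ {u} {a} {b} u₀≡1 ua≈ub n = ℤ.i-j≡0⇒i≡j (a n) (b n) (unit-⊛-order (suc n) u₀≡1 u[a-b]≈0 n ℕ.≤-refl)
    where
    u[a-b]≈0 : u ⊛ (a ⊕ ⊝ b) ≈[< suc n ] 0S
    u[a-b]≈0 i _ = trans (solve 3 (λ u a b → u :* (a :- b) := u :* a :- u :* b) ≈-refl u a b i)
                         (ℤ.i≡j⇒i-j≡0 (ua≈ub i))

module LinearCombination {c ℓ : Level} (R : CommutativeRing c ℓ) where

  open import Level using (_⊔_)
  open CommutativeRing R
  open import Algebra.Properties.Group +-group using (x∙y⁻¹≈ε⇒x≈y; x≈y⇒x∙y⁻¹≈ε)
  open import Relation.Binary.Reasoning.Setoid setoid

  -- In use, the ring solver proves a - b ≈ s, and the coefficients k of the combination are inferred from it.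
  infix  4 _·_
  infixr 3 _⊞_

  data Combination : Carrier → Set (c ⊔ ℓ) where
    _·_ : ∀ {x y} k → x ≈ y → Combination (k * (x - y))
    _⊞_ : ∀ {s s′} → Combination s → Combination s′ → Combination (s + s′)

  combination≈0 : ∀ {s} → Combination s → s ≈ 0#
  combination≈0 (_·_ {x} {y} k x≈y) = begin
    k * (x - y) ≈⟨ *-congˡ (x≈y⇒x∙y⁻¹≈ε x≈y) ⟩
    k * 0#      ≈⟨ zeroʳ k ⟩
    0#          ∎
  combination≈0 (p ⊞ q) = trans (+-cong (combination≈0 p) (combination≈0 q)) (+-identityˡ 0#)

  linear-combination : ∀ {a b s} → Combination s → a - b ≈ s → a ≈ b
  linear-combination {a} {b} p a-b≈s = x∙y⁻¹≈ε⇒x≈y a b (trans a-b≈s (combination≈0 p))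

module WalkCounts where

  open import Data.Bool using (true; false)
  open import Data.Empty using (⊥-elim)
  open import Data.Integer as ℤ using (ℤ; +_; 0ℤ; 1ℤ; -[1+_]; +≤+)
  import Data.Integer.Properties as ℤ
  open import Data.Integer.Tactic.RingSolver using (solve-∀)
  open import Data.List using ([]; _∷_; _++_; map; filter; length)
  open import Data.List.Properties using (filter-++; filter-≐; filter-none; length-++)
  open import Data.List.Relation.Unary.All as All using (All; []; _∷_; all?)
  open import Data.List.Relation.Unary.All.Properties using (¬Any⇒All¬; All¬⇒¬Any)
  open import Data.List.Relation.Unary.Any using (any?)
  open import Data.Nat using (ℕ; zero; suc; _+_; _*_; _≤?_; z≤n)
  import Data.Nat.Properties as ℕ
  open import Data.Nat.Tactic.RingSolver using () renaming (solve-∀ to ℕ-solve-∀)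
  open import Data.Product using (_×_; _,_; proj₁; proj₂)
  open import Relation.Binary.PropositionalEquality
  open import Relation.Nullary using (Dec; yes; no; ¬_)
  open import Relation.Nullary.Decidable using (_×-dec_; ¬?)
  open import Relation.Unary using (Decidable; _≐_)

  𝟙 : ∀ {A : Set} → Dec A → ℕ
  𝟙 (yes _) = 1
  𝟙 (no _)  = 0

  𝟙-yes : ∀ {A : Set} (d : Dec A) → A → 𝟙 d ≡ 1
  𝟙-yes (yes _) _ = refl
  𝟙-yes (no ¬a) a = ⊥-elim (¬a a)

  𝟙-no : ∀ {A : Set} (d : Dec A) → ¬ A → 𝟙 d ≡ 0
  𝟙-no (yes a) ¬a = ⊥-elim (¬a a)
  𝟙-no (no _)  _  = refl

  𝟙-cong : ∀ {A B : Set} (a : Dec A) (b : Dec B) → (A → B) → (B → A) → 𝟙 a ≡ 𝟙 b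
  𝟙-cong (yes a) b f g = sym (𝟙-yes b (f a))
  𝟙-cong (no ¬a) b f g = sym (𝟙-no b (λ y → ¬a (g y)))

  𝟙-× : ∀ {A B : Set} (a : Dec A) (b : Dec B) → 𝟙 (a ×-dec b) ≡ 𝟙 a * 𝟙 b
  𝟙-× (yes _) (yes _) = refl
  𝟙-× (yes _) (no _)  = refl
  𝟙-× (no _)  _       = refl

  module _ {A : Set} {P : A → Set} (P? : Decidable P) where

    length-filter-[_] : ∀ p → length (filter P? (p ∷ [])) ≡ 𝟙 (P? p)
    length-filter-[ p ] with P? p
    ... | yes _ = refl
    ... | no _  = refl

    length-filter-map : ∀ {B : Set} (f : B → A) ps → length (filter P? (map f ps)) ≡ length (filter (λ p → P? (f p)) ps)
    length-filter-map f []       = refl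
    length-filter-map f (p ∷ ps) with P? (f p)
    ... | yes _ = cong suc (length-filter-map f ps)
    ... | no _  = length-filter-map f ps

    length-filter-split : ∀ {Q : A → Set} (Q? : Decidable Q) ps →
      length (filter P? ps) ≡ length (filter (λ p → P? p ×-dec Q? p) ps) + length (filter (λ p → P? p ×-dec ¬? (Q? p)) ps)
    length-filter-split Q? []       = refl
    length-filter-split Q? (p ∷ ps) with P? p | Q? p
    ... | yes _ | yes _ = cong suc (length-filter-split Q? ps)
    ... | yes _ | no _  = trans (cong suc (length-filter-split Q? ps)) (sym (ℕ.+-suc _ _))
    ... | no _  | _     = length-filter-split Q? ps

  InStrip : ℕ → ℤ → Set
  InStrip k y = (0ℤ ℤ.≤ y) × (y ℤ.≤ + k)

  inStrip? : ∀ k y → Dec (InStrip k y)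
  inStrip? k y = (0ℤ ℤ.≤? y) ×-dec (y ℤ.≤? + k)

  Walk : ℕ → ℤ → ℤ → Path → Set
  Walk k z e p = All (InStrip k) (levels z p) × (endLevel z p ≡ e)

  walk? : ∀ k z e p → Dec (Walk k z e p)
  walk? k z e p = all? (inStrip? k) (levels z p) ×-dec (endLevel z p ℤ.≟ e)

  -- Gc k j n is definitionally walks k 0ℤ (+ j) n; the free start level z is what the first-step recursion needs.
  walks : ℕ → ℤ → ℤ → ℕ → ℕ
  walks k z e n = length (filter (walk? k z e) (paths n))

  walks-zero : ∀ k z e → walks k z e 0 ≡ 𝟙 (inStrip? k z) * 𝟙 (z ℤ.≟ e)
  walks-zero k z e = begin
    walks k z e 0                              ≡⟨ length-filter-[ walk? k z e ] [] ⟩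
    𝟙 (walk? k z e [])                         ≡⟨ 𝟙-cong (walk? k z e []) (inStrip? k z ×-dec (z ℤ.≟ e))
                                                     (λ { (s ∷ [] , eq) → s , eq }) (λ { (s , eq) → s ∷ [] , eq }) ⟩
    𝟙 (inStrip? k z ×-dec (z ℤ.≟ e))           ≡⟨ 𝟙-× (inStrip? k z) (z ℤ.≟ e) ⟩
    𝟙 (inStrip? k z) * 𝟙 (z ℤ.≟ e)            ∎
    where open ≡-Reasoning

  walks-suc : ∀ k z e n →
    walks k z e (suc n) ≡ 𝟙 (inStrip? k z) * (walks k (z ℤ.+ 1ℤ) e n + walks k (z ℤ.- 1ℤ) e n)
  walks-suc k z e n = begin
    walks k z e (suc n)
      ≡⟨ cong length (filter-++ (walk? k z e) (map (true ∷_) (paths n)) (map (false ∷_) (paths n))) ⟩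
    length (filter (walk? k z e) (map (true ∷_) (paths n)) ++ filter (walk? k z e) (map (false ∷_) (paths n)))
      ≡⟨ length-++ (filter (walk? k z e) (map (true ∷_) (paths n))) ⟩
    length (filter (walk? k z e) (map (true ∷_) (paths n))) + length (filter (walk? k z e) (map (false ∷_) (paths n)))
      ≡⟨ cong₂ _+_ (length-filter-map (walk? k z e) (true ∷_) (paths n)) (length-filter-map (walk? k z e) (false ∷_) (paths n)) ⟩
    firstUp + firstDown
      ≡⟨ split (inStrip? k z) ⟩
    𝟙 (inStrip? k z) * (walks k (z ℤ.+ 1ℤ) e n + walks k (z ℤ.- 1ℤ) e n) ∎
    where
    open ≡-Reasoning
    firstUp firstDown : ℕ
    firstUp   = length (filter (λ p → walk? k z e (true ∷ p)) (paths n))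
    firstDown = length (filter (λ p → walk? k z e (false ∷ p)) (paths n))
    peel : ∀ b → InStrip k z → (λ p → Walk k z e (b ∷ p)) ≐ Walk k (step z b) e
    peel b z∈ = (λ { (_ ∷ w , eq) → w , eq }) , (λ { (w , eq) → z∈ ∷ w , eq })
    stuck : ∀ b → ¬ InStrip k z → length (filter (λ p → walk? k z e (b ∷ p)) (paths n)) ≡ 0
    stuck b z∉ = cong length (filter-none _ (All.universal (λ { _ (z∈ ∷ _ , _) → z∉ z∈ }) (paths n)))
    split : (d : Dec (InStrip k z)) → firstUp + firstDown ≡ 𝟙 d * (walks k (z ℤ.+ 1ℤ) e n + walks k (z ℤ.- 1ℤ) e n)
    split (yes z∈) = trans
      (cong₂ _+_ (cong length (filter-≐ _ (walk? k (z ℤ.+ 1ℤ) e) (peel true z∈) (paths n)))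
                 (cong length (filter-≐ _ (walk? k (z ℤ.- 1ℤ) e) (peel false z∈) (paths n))))
      (sym (ℕ.+-identityʳ _))
    split (no z∉) = cong₂ _+_ (stuck true z∉) (stuck false z∉)

  private
    up-down : ∀ z → (z ℤ.+ 1ℤ) ℤ.- 1ℤ ≡ z
    up-down = solve-∀
    down-up : ∀ z → (z ℤ.- 1ℤ) ℤ.+ 1ℤ ≡ z
    down-up = solve-∀

    swap-*1 : ∀ a b → a * (b * 1) ≡ b * (a * 1)
    swap-*1 = ℕ-solve-∀

    swap-*0 : ∀ a b c → a * (b * 0) ≡ c * (a * 0)
    swap-*0 = ℕ-solve-∀

    swap-factors : ∀ s t a b c d → s * (t * (a + b) + t * (c + d)) ≡ t * (s * (a + c) + s * (b + d))
    swap-factors = ℕ-solve-∀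

    -- A one-step walk from z to y = e, described from its end e instead of its start z.
    one-step-reversal : ∀ k y z e w → (y ≡ e → z ≡ w) → (z ≡ w → y ≡ e) →
      𝟙 (inStrip? k z) * (𝟙 (inStrip? k y) * 𝟙 (y ℤ.≟ e)) ≡ 𝟙 (inStrip? k e) * (𝟙 (inStrip? k z) * 𝟙 (z ℤ.≟ w))
    one-step-reversal k y z e w to from with y ℤ.≟ e | z ℤ.≟ w
    ... | yes refl | yes _   = swap-*1 (𝟙 (inStrip? k z)) (𝟙 (inStrip? k y))
    ... | yes y≡e  | no z≢w  = ⊥-elim (z≢w (to y≡e))
    ... | no y≢e   | yes z≡w = ⊥-elim (y≢e (from z≡w))
    ... | no _     | no _    = swap-*0 (𝟙 (inStrip? k z)) (𝟙 (inStrip? k y)) (𝟙 (inStrip? k e))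

  walks-suc-last : ∀ k z e n →
    walks k z e (suc n) ≡ 𝟙 (inStrip? k e) * (walks k z (e ℤ.- 1ℤ) n + walks k z (e ℤ.+ 1ℤ) n)
  walks-suc-last k z e zero = begin
    walks k z e 1
      ≡⟨ walks-suc k z e 0 ⟩
    ∣z∣ * (walks k (z ℤ.+ 1ℤ) e 0 + walks k (z ℤ.- 1ℤ) e 0)
      ≡⟨ cong (∣z∣ *_) (cong₂ _+_ (walks-zero k (z ℤ.+ 1ℤ) e) (walks-zero k (z ℤ.- 1ℤ) e)) ⟩
    ∣z∣ * (𝟙 (inStrip? k (z ℤ.+ 1ℤ)) * 𝟙 (z ℤ.+ 1ℤ ℤ.≟ e) + 𝟙 (inStrip? k (z ℤ.- 1ℤ)) * 𝟙 (z ℤ.- 1ℤ ℤ.≟ e))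
      ≡⟨ ℕ.*-distribˡ-+ ∣z∣ _ _ ⟩
    ∣z∣ * (𝟙 (inStrip? k (z ℤ.+ 1ℤ)) * 𝟙 (z ℤ.+ 1ℤ ℤ.≟ e)) + ∣z∣ * (𝟙 (inStrip? k (z ℤ.- 1ℤ)) * 𝟙 (z ℤ.- 1ℤ ℤ.≟ e))
      ≡⟨ cong₂ _+_ (one-step-reversal k (z ℤ.+ 1ℤ) z e (e ℤ.- 1ℤ) (λ { refl → sym (up-down z) }) (λ { refl → down-up e }))
                   (one-step-reversal k (z ℤ.- 1ℤ) z e (e ℤ.+ 1ℤ) (λ { refl → sym (down-up z) }) (λ { refl → up-down e })) ⟩
    ∣e∣ * (∣z∣ * 𝟙 (z ℤ.≟ e ℤ.- 1ℤ)) + ∣e∣ * (∣z∣ * 𝟙 (z ℤ.≟ e ℤ.+ 1ℤ))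
      ≡⟨ ℕ.*-distribˡ-+ ∣e∣ _ _ ⟨
    ∣e∣ * (∣z∣ * 𝟙 (z ℤ.≟ e ℤ.- 1ℤ) + ∣z∣ * 𝟙 (z ℤ.≟ e ℤ.+ 1ℤ))
      ≡⟨ cong (∣e∣ *_) (cong₂ _+_ (walks-zero k z (e ℤ.- 1ℤ)) (walks-zero k z (e ℤ.+ 1ℤ))) ⟨
    ∣e∣ * (walks k z (e ℤ.- 1ℤ) 0 + walks k z (e ℤ.+ 1ℤ) 0) ∎
    where
    open ≡-Reasoning
    ∣z∣ = 𝟙 (inStrip? k z)
    ∣e∣ = 𝟙 (inStrip? k e)
  walks-suc-last k z e (suc n) = begin
    walks k z e (suc (suc n))
      ≡⟨ walks-suc k z e (suc n) ⟩
    ∣z∣ * (walks k (z ℤ.+ 1ℤ) e (suc n) + walks k (z ℤ.- 1ℤ) e (suc n))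
      ≡⟨ cong (∣z∣ *_) (cong₂ _+_ (walks-suc-last k (z ℤ.+ 1ℤ) e n) (walks-suc-last k (z ℤ.- 1ℤ) e n)) ⟩
    ∣z∣ * (∣e∣ * (a + b) + ∣e∣ * (c + d))
      ≡⟨ swap-factors ∣z∣ ∣e∣ a b c d ⟩
    ∣e∣ * (∣z∣ * (a + c) + ∣z∣ * (b + d))
      ≡⟨ cong (∣e∣ *_) (cong₂ _+_ (walks-suc k z (e ℤ.- 1ℤ) n) (walks-suc k z (e ℤ.+ 1ℤ) n)) ⟨
    ∣e∣ * (walks k z (e ℤ.- 1ℤ) (suc n) + walks k z (e ℤ.+ 1ℤ) (suc n)) ∎
    where
    open ≡-Reasoning
    ∣z∣ = 𝟙 (inStrip? k z)
    ∣e∣ = 𝟙 (inStrip? k e)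
    a = walks k (z ℤ.+ 1ℤ) (e ℤ.- 1ℤ) n
    b = walks k (z ℤ.+ 1ℤ) (e ℤ.+ 1ℤ) n
    c = walks k (z ℤ.- 1ℤ) (e ℤ.- 1ℤ) n
    d = walks k (z ℤ.- 1ℤ) (e ℤ.+ 1ℤ) n

  walks-to-minus-one : ∀ k z n → walks k z -[1+ 0 ] n ≡ 0
  walks-to-minus-one k z zero    = trans (walks-zero k z -[1+ 0 ]) (nowhere z)
    where
    nowhere : ∀ z → 𝟙 (inStrip? k z) * 𝟙 (z ℤ.≟ -[1+ 0 ]) ≡ 0
    nowhere z with z ℤ.≟ -[1+ 0 ]
    ... | yes refl = refl
    ... | no _     = ℕ.*-zeroʳ (𝟙 (inStrip? k z))
  walks-to-minus-one k z (suc n) = walks-suc-last k z -[1+ 0 ] n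

  Gc-suc-zero : ∀ k n → Gc k 0 (suc n) ≡ Gc k 1 n
  Gc-suc-zero k n = begin
    Gc k 0 (suc n)                                      ≡⟨ walks-suc-last k 0ℤ 0ℤ n ⟩
    walks k 0ℤ -[1+ 0 ] n + Gc k 1 n + 0               ≡⟨ ℕ.+-identityʳ _ ⟩
    walks k 0ℤ -[1+ 0 ] n + Gc k 1 n                   ≡⟨ cong (_+ Gc k 1 n) (walks-to-minus-one k 0ℤ n) ⟩
    Gc k 1 n                                            ∎
    where open ≡-Reasoning

  Gc-suc-suc : ∀ k j n → Gc k (suc j) (suc n) ≡ 𝟙 (suc j ≤? k) * (Gc k j n + Gc k (suc (suc j)) n)
  Gc-suc-suc k j n = trans (walks-suc-last k 0ℤ (+ suc j) n) (cong₂ _*_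
    (𝟙-cong (inStrip? k (+ suc j)) (suc j ≤? k) (λ { (_ , +≤+ j<k) → j<k }) (λ j<k → +≤+ z≤n , +≤+ j<k))
    (cong (λ i → Gc k j n + walks k 0ℤ (+ i) n) (ℕ.+-comm (suc j) 1)))

  private
    InStrip-shrink : ∀ k y → InStrip (suc k) y → y ≢ + suc k → InStrip k y
    InStrip-shrink k (+ m) (0≤y , +≤+ m≤1+k) y≢1+k = 0≤y , +≤+ (ℕ.≤-pred (ℕ.≤∧≢⇒< m≤1+k (λ m≡1+k → y≢1+k (cong +_ m≡1+k))))

    InStrip-grow : ∀ k y → InStrip k y → InStrip (suc k) y × y ≢ + suc k
    InStrip-grow k (+ m) (0≤y , +≤+ m≤k) = (0≤y , +≤+ (ℕ.m≤n⇒m≤1+n m≤k)) , λ { refl → ℕ.<-irrefl refl m≤k }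

  Hc+Gc : ∀ k j n → Hc (suc k) j n + Gc k j n ≡ Gc (suc k) j n
  Hc+Gc k j n = sym (trans
    (length-filter-split (ballotLe? (suc k) j) (λ p → any? (λ y → y ℤ.≟ + suc k) (levels 0ℤ p)) (paths n))
    (cong (λ m → Hc (suc k) j n + m) (cong length (filter-≐ _ (ballotLe? k j) (shrink , grow) (paths n)))))
    where
    shrink : ∀ {p} → BallotLe (suc k) j p × ¬ _ → BallotLe k j p
    shrink {p} ((inside , end) , untouched) =
      All.zipWith (λ { (y∈ , y≢) → InStrip-shrink k _ y∈ y≢ }) (inside , ¬Any⇒All¬ (levels 0ℤ p) untouched) , end
    grow : ∀ {p} → BallotLe k j p → BallotLe (suc k) j p × ¬ _
    grow (inside , end) = (All.map (λ y∈ → proj₁ (InStrip-grow k _ y∈)) inside , end)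
                        , All¬⇒¬Any (All.map (λ y∈ → proj₂ (InStrip-grow k _ y∈)) inside)

module BallotNumbers where

  open WalkCounts
  open import Data.Nat using (ℕ; zero; suc; _+_; _*_; _≤_; _<_; _≤?_; s≤s; _!)
  import Data.Nat.Properties as ℕ
  open import Data.Nat.Tactic.RingSolver using (solve-∀)
  open import Relation.Binary.PropositionalEquality
  open import Relation.Nullary using (yes; no)
  open ≡-Reasoning

  -- Paths of n steps from level 0 to level j that never go below 0: Gc without the ceiling.
  ballot : ℕ → ℕ → ℕ
  ballot zero    j       = δ0 j
  ballot (suc n) zero    = ballot n 1
  ballot (suc n) (suc j) = ballot n j + ballot n (suc (suc j))

  ballot-vanishes : ∀ {n j} → n < j → ballot n j ≡ 0
  ballot-vanishes {zero}  {suc j} n<j       = refl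
  ballot-vanishes {suc n} {suc j} (s≤s n<j) =
    cong₂ _+_ (ballot-vanishes n<j) (ballot-vanishes (ℕ.m<n⇒m<1+n (ℕ.m<n⇒m<1+n n<j)))

  -- A path of n ≤ k steps cannot reach height k + 1.
  Gc-stable : ∀ {k n} j → n ≤ k → Gc k j n ≡ ballot n j
  Gc-stable {k} {zero}  zero    _   = refl
  Gc-stable {k} {zero}  (suc j) _   = refl
  Gc-stable {k} {suc n} zero    n<k = trans (Gc-suc-zero k n) (Gc-stable 1 (ℕ.<⇒≤ n<k))
  Gc-stable {k} {suc n} (suc j) n<k with suc j ≤? k
  ... | yes j<k = begin
    Gc k (suc j) (suc n)                         ≡⟨ Gc-suc-suc k j n ⟩
    𝟙 (suc j ≤? k) * (Gc k j n + Gc k (suc (suc j)) n) ≡⟨ cong (_* (Gc k j n + Gc k (suc (suc j)) n)) (𝟙-yes (suc j ≤? k) j<k) ⟩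
    1 * (Gc k j n + Gc k (suc (suc j)) n)        ≡⟨ ℕ.*-identityˡ _ ⟩
    Gc k j n + Gc k (suc (suc j)) n              ≡⟨ cong₂ _+_ (Gc-stable j (ℕ.<⇒≤ n<k)) (Gc-stable (suc (suc j)) (ℕ.<⇒≤ n<k)) ⟩
    ballot n j + ballot n (suc (suc j))          ∎
  ... | no j≮k = begin
    Gc k (suc j) (suc n)                         ≡⟨ Gc-suc-suc k j n ⟩
    𝟙 (suc j ≤? k) * (Gc k j n + Gc k (suc (suc j)) n) ≡⟨ cong (_* (Gc k j n + Gc k (suc (suc j)) n)) (𝟙-no (suc j ≤? k) j≮k) ⟩
    0                                            ≡⟨ cong₂ _+_ (ballot-vanishes n<j) (ballot-vanishes (ℕ.m<n⇒m<1+n (ℕ.m<n⇒m<1+n n<j))) ⟨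
    ballot n j + ballot n (suc (suc j))          ∎
    where
    n<j : n < j
    n<j = ℕ.≤-pred (ℕ.≤-trans (s≤s n<k) (ℕ.≰⇒> j≮k))

  ballot-diagonal : ∀ j → ballot j j ≡ 1
  ballot-diagonal zero    = refl
  ballot-diagonal (suc j) = cong₂ _+_ (ballot-diagonal j) (ballot-vanishes (ℕ.m<n⇒m<1+n (ℕ.n<1+n j)))

  -- n = 2m + j and f = m + j + 1 come with defining equations so that no recursive call needs index rewriting.
  ballot-formula : ∀ m j {n f} → n ≡ m + m + j → f ≡ suc (m + j) → ballot n j * (m ! * f !) ≡ suc j * n !
  ballot-formula zero j refl refl = begin
    ballot j j * (1 * suc j !) ≡⟨ cong (_* (1 * suc j !)) (ballot-diagonal j) ⟩
    1 * (1 * suc j !)          ≡⟨ ℕ.*-identityˡ _ ⟩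
    1 * suc j !                ≡⟨ ℕ.*-identityˡ _ ⟩
    suc j !                    ∎
  ballot-formula (suc m) zero {f = f} refl refl = begin
    ballot n 1 * ((suc m * m !) * F)     ≡⟨ reassoc (ballot n 1) (suc m) (m !) F ⟩
    suc m * (ballot n 1 * (m ! * F))     ≡⟨ cong (suc m *_) (ballot-formula m 1 (n≡ m) (f≡ m)) ⟩
    suc m * (2 * n !)                    ≡⟨ double m (n !) ⟩
    1 * (suc n * n !)                    ∎
    where
    n = m + suc m + 0
    F = f !
    reassoc : ∀ a s g h → a * ((s * g) * h) ≡ s * (a * (g * h))
    reassoc = solve-∀
    n≡ : ∀ m → m + suc m + 0 ≡ m + m + 1
    n≡ = solve-∀
    f≡ : ∀ m → suc (suc (m + 0)) ≡ suc (m + 1)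
    f≡ = solve-∀
    double : ∀ m a → suc m * (2 * a) ≡ 1 * (suc (m + suc m + 0) * a)
    double = solve-∀
  ballot-formula (suc m) (suc j) refl refl = begin
    (x + y) * ((suc m * m !) * (sb * B))
      ≡⟨ split (suc m) (m !) sb B x y ⟩
    sb * (x * (suc m ! * B)) + suc m * (y * (m ! * sb !))
      ≡⟨ cong₂ (λ u v → sb * u + suc m * v) (ballot-formula (suc m) j (n≡₁ m j) (cong suc (ℕ.+-suc m j)))
                                            (ballot-formula m (suc (suc j)) (n≡₂ m j) (cong suc (sym (ℕ.+-suc m (suc j))))) ⟩
    sb * (suc j * n !) + suc m * (suc (suc (suc j)) * n !)
      ≡⟨ combine m j (n !) ⟩
    suc (suc j) * (suc n * n !) ∎
    where
    n  = m + suc m + suc j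
    x  = ballot n j
    y  = ballot n (suc (suc j))
    sb = suc (suc (m + suc j))
    B  = suc (m + suc j) !
    split : ∀ s g t b x y → (x + y) * ((s * g) * (t * b)) ≡ t * (x * ((s * g) * b)) + s * (y * (g * (t * b)))
    split = solve-∀
    n≡₁ : ∀ m j → m + suc m + suc j ≡ suc m + suc m + j
    n≡₁ = solve-∀
    n≡₂ : ∀ m j → m + suc m + suc j ≡ m + m + suc (suc j)
    n≡₂ = solve-∀
    combine : ∀ m j a → suc (suc (m + suc j)) * (suc j * a) + suc m * (suc (suc (suc j)) * a)
                        ≡ suc (suc j) * (suc (m + suc m + suc j) * a)
    combine = solve-∀

  catalan : ℕ → ℕ
  catalan n = ballot (n + n) 0

  catalan-formula : ∀ n → catalan n * (n ! * suc n !) ≡ (n + n) !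
  catalan-formula n = begin
    catalan n * (n ! * suc n !) ≡⟨ ballot-formula n 0 (sym (ℕ.+-identityʳ (n + n))) (cong suc (sym (ℕ.+-identityʳ n))) ⟩
    1 * (n + n) !               ≡⟨ ℕ.*-identityˡ _ ⟩
    (n + n) !                   ∎

  catalan-recurrence : ∀ n → suc (suc n) * catalan (suc n) ≡ 2 * suc (n + n) * catalan n
  catalan-recurrence n = ℕ.*-cancelʳ-≡ _ _ (suc n * (n ! * suc n !)) {{ℕ.m*n≢0 (suc n) _ {{_}} {{n ℕ.!* suc n !≢0}}}} (begin
    suc (suc n) * catalan (suc n) * (suc n * (n ! * suc n !))
      ≡⟨ regroupˡ (suc n) (catalan (suc n)) (n !) ⟩
    catalan (suc n) * (suc n ! * suc (suc n) !)
      ≡⟨ catalan-formula (suc n) ⟩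
    suc (n + suc n) * (n + suc n) !
      ≡⟨ cong (λ i → suc (n + suc n) * i !) (ℕ.+-suc n n) ⟩
    suc (n + suc n) * (suc (n + n) * (n + n) !)
      ≡⟨ cong (λ i → suc (n + suc n) * (suc (n + n) * i)) (catalan-formula n) ⟨
    suc (n + suc n) * (suc (n + n) * (catalan n * (n ! * suc n !)))
      ≡⟨ regroupʳ n (catalan n) (n !) ⟩
    2 * suc (n + n) * catalan n * (suc n * (n ! * suc n !)) ∎)
    where
    regroupˡ : ∀ s c f → suc s * c * (s * (f * (s * f))) ≡ c * ((s * f) * (suc s * (s * f)))
    regroupˡ = solve-∀
    regroupʳ : ∀ n c f → suc (n + suc n) * (suc (n + n) * (c * (f * (suc n * f)))) ≡ 2 * suc (n + n) * c * (suc n * (f * (suc n * f)))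
    regroupʳ = solve-∀

  -- 16 C(n) - 8 C(n+1) + C(n+2) = T(3,n) = 60 (2n)! / (n! (n+3)!), written without subtraction or division.
  catalan-T₃ : ∀ n r → r + 8 * catalan (suc n) ≡ 16 * catalan n + catalan (suc (suc n)) → r * (n ! * (n + 3) !) ≡ 60 * (2 * n) !
  catalan-T₃ n r r≡ = begin
    r * (n ! * (n + 3) !)                     ≡⟨ cong (λ i → r * (n ! * i !)) (ℕ.+-comm n 3) ⟩
    r * (n ! * (3 + n) !)                     ≡⟨ unfold-! n r (n !) ⟩
    (s₂ * s₃ * r) * (n ! * suc n !)           ≡⟨ cong (_* (n ! * suc n !)) scaled ⟩
    60 * a * (n ! * suc n !)                  ≡⟨ ℕ.*-assoc 60 a _ ⟩
    60 * (a * (n ! * suc n !))                ≡⟨ cong (60 *_) (catalan-formula n) ⟩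
    60 * (n + n) !                            ≡⟨ cong (λ i → 60 * i !) (cong (n +_) (ℕ.+-identityʳ n)) ⟨
    60 * (2 * n) !                            ∎
    where
    a = catalan n
    b = catalan (suc n)
    c = catalan (suc (suc n))
    s₂ = suc (suc n)
    s₃ = suc s₂
    d₁ = suc (n + n)
    d₃ = suc (suc n + suc n)
    unfold-! : ∀ n r f → r * (f * (suc (suc (suc n)) * (suc (suc n) * (suc n * f)))) ≡ (suc (suc n) * suc (suc (suc n)) * r) * (f * (suc n * f))
    unfold-! = solve-∀
    scaled : s₂ * s₃ * r ≡ 60 * a
    scaled = ℕ.+-cancelʳ-≡ (16 * (s₃ * d₁ * a)) _ _ (begin
      s₂ * s₃ * r + 16 * (s₃ * d₁ * a)        ≡⟨ cong (s₂ * s₃ * r +_) (sixteen-as-eight-twos s₃ d₁ a) ⟩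
      s₂ * s₃ * r + 8 * s₃ * (2 * d₁ * a)     ≡⟨ cong (λ i → s₂ * s₃ * r + 8 * s₃ * i) (catalan-recurrence n) ⟨
      s₂ * s₃ * r + 8 * s₃ * (s₂ * b)         ≡⟨ factor-st s₂ s₃ r b ⟩
      s₂ * s₃ * (r + 8 * b)                   ≡⟨ cong (s₂ * s₃ *_) r≡ ⟩
      s₂ * s₃ * (16 * a + c)                  ≡⟨ expand-st s₂ s₃ a c ⟩
      16 * (s₂ * s₃ * a) + s₂ * (s₃ * c)      ≡⟨ cong (λ i → 16 * (s₂ * s₃ * a) + s₂ * i) (catalan-recurrence (suc n)) ⟩
      16 * (s₂ * s₃ * a) + s₂ * (2 * d₃ * b)  ≡⟨ cong (16 * (s₂ * s₃ * a) +_) (commute-s s₂ d₃ b) ⟩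
      16 * (s₂ * s₃ * a) + 2 * d₃ * (s₂ * b)  ≡⟨ cong (λ i → 16 * (s₂ * s₃ * a) + 2 * d₃ * i) (catalan-recurrence n) ⟩
      16 * (s₂ * s₃ * a) + 2 * d₃ * (2 * d₁ * a) ≡⟨ sixty n a ⟩
      60 * a + 16 * (s₃ * d₁ * a)             ∎)
      where
      sixteen-as-eight-twos : ∀ s d a → 16 * (s * d * a) ≡ 8 * s * (2 * d * a)
      sixteen-as-eight-twos = solve-∀
      factor-st : ∀ s t r b → s * t * r + 8 * t * (s * b) ≡ s * t * (r + 8 * b)
      factor-st = solve-∀
      expand-st : ∀ s t a c → s * t * (16 * a + c) ≡ 16 * (s * t * a) + s * (t * c)
      expand-st = solve-∀
      commute-s : ∀ s d b → s * (2 * d * b) ≡ 2 * d * (s * b)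
      commute-s = solve-∀
      sixty : ∀ n a → 16 * (suc (suc n) * suc (suc (suc n)) * a) + 2 * suc (suc n + suc n) * (2 * suc (n + n) * a)
                      ≡ 60 * a + 16 * (suc (suc (suc n)) * suc (n + n) * a)
      sixty = solve-∀

module ClosedForms where

  open PowerSeries
  open LinearCombination seriesRing using (linear-combination; _·_; _⊞_)
  open WalkCounts using (𝟙; 𝟙-yes; 𝟙-no; Gc-suc-zero; Gc-suc-suc; Hc+Gc)
  open import Data.Integer as ℤ using (ℤ; +_; 0ℤ)
  import Data.Integer.Properties as ℤ
  open import Data.Nat as ℕ using (ℕ; zero; suc; _≤_; _≤?_)
  import Data.Nat.Properties as ℕ
  open import Relation.Binary.PropositionalEquality

  F : ℕ → Series
  F zero          = 0S
  F (suc zero)    = 1S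
  F (suc (suc k)) = F (suc k) ⊕ ⊝ (X ⊛ F k)

  G : ℕ → ℕ → Series
  G k j n = + Gc k j n

  H : ℕ → ℕ → Series
  H k j n = + Hc k j n

  G-level-zero : ∀ k → G k 0 ≈ 1S ⊕ T ⊛ G k 1
  G-level-zero k zero    = refl
  G-level-zero k (suc n) = trans (cong +_ (Gc-suc-zero k n)) (sym (trans (ℤ.+-identityˡ _) (T-⊛-suc (G k 1) n)))

  G-level-suc : ∀ k j → suc j ≤ k → G k (suc j) ≈ T ⊛ (G k j ⊕ G k (suc (suc j)))
  G-level-suc k j j<k zero    = refl
  G-level-suc k j j<k (suc n) = begin
    + Gc k (suc j) (suc n)                                          ≡⟨ cong +_ (Gc-suc-suc k j n) ⟩
    + (𝟙 (suc j ≤? k) ℕ.* (Gc k j n ℕ.+ Gc k (suc (suc j)) n))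
      ≡⟨ cong (λ i → + (i ℕ.* (Gc k j n ℕ.+ Gc k (suc (suc j)) n))) (𝟙-yes (suc j ≤? k) j<k) ⟩
    + (1 ℕ.* (Gc k j n ℕ.+ Gc k (suc (suc j)) n))                   ≡⟨ cong +_ (ℕ.*-identityˡ _) ⟩
    + (Gc k j n ℕ.+ Gc k (suc (suc j)) n)                           ≡⟨ ℤ.pos-+ (Gc k j n) _ ⟩
    (G k j ⊕ G k (suc (suc j))) n                                   ≡⟨ T-⊛-suc _ n ⟨
    (T ⊛ (G k j ⊕ G k (suc (suc j)))) (suc n)                       ∎
    where open ≡-Reasoning

  G-above-ceiling : ∀ k → G k (suc k) ≈ 0S
  G-above-ceiling k zero    = refl
  G-above-ceiling k (suc n) = cong +_ (trans (Gc-suc-suc k k n)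
    (cong (ℕ._* (Gc k k n ℕ.+ Gc k (suc (suc k)) n)) (𝟙-no (suc k ≤? k) (ℕ.<-irrefl refl))))

  private
    defect : ℕ → ℕ → ℕ → Series
    defect k j r = F (suc (suc k)) ⊛ G k j ⊕ ⊝ (T ^ j ⊛ F r)

    defect-bottom : ∀ k → defect k 0 (suc k) ≈ T ⊛ defect k 1 k
    defect-bottom k = linear-combination (_ · G-level-zero k)
      (solve 5 (λ f₁ f₀ t g₀ g₁ →
         let f₂ = f₁ :- t :* t :* f₀ in
         (f₂ :* g₀ :- con (+ 1) :* f₁) :- t :* (f₂ :* g₁ :- t :* con (+ 1) :* f₀)
           := f₂ :* (g₀ :- (con (+ 1) :+ t :* g₁)))
       ≈-refl (F (suc k)) (F k) T (G k 0) (G k 1))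

    defect-middle : ∀ k j r → suc j ≤ k → defect k (suc j) (suc r) ≈ T ⊛ (defect k j (suc (suc r)) ⊕ defect k (suc (suc j)) r)
    defect-middle k j r j<k = linear-combination (_ · G-level-suc k j j<k)
      (solve 8 (λ f gA gB gC t tʲ p₀ p₁ →
         (f :* gB :- (t :* tʲ) :* p₁) :- t :* ((f :* gA :- tʲ :* (p₁ :- t :* t :* p₀)) :+ (f :* gC :- (t :* (t :* tʲ)) :* p₀))
           := f :* (gB :- t :* (gA :+ gC)))
       ≈-refl (F (suc (suc k))) (G k j) (G k (suc j)) (G k (suc (suc j))) T (T ^ j) (F r) (F (suc r)))

    defect-top : ∀ k → defect k (suc k) 0 ≈ 0S
    defect-top k n = cong₂ ℤ._+_
      (trans (⊛-comm (F (suc (suc k))) _ n) (⊛-annihilˡ _ (G-above-ceiling k) n))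
      (cong ℤ.-_ (trans (⊛-comm (T ^ suc k) 0S n) (⊛-annihilˡ _ ≈-refl n)))

    -- Each defect is T times a sum of defects with the same j + r (or 0 at the top level),
    -- so its coefficients vanish by induction on their index.
    defect-vanishes : ∀ k n j r → j ℕ.+ r ≡ suc k → defect k j r n ≡ 0ℤ
    defect-vanishes k n zero .(suc k) refl = trans (defect-bottom k n) (T-⊛-below n)
      where
      T-⊛-below : ∀ n → (T ⊛ defect k 1 k) n ≡ 0ℤ
      T-⊛-below zero    = refl
      T-⊛-below (suc n) = trans (T-⊛-suc _ n) (defect-vanishes k n 1 k refl)
    defect-vanishes k n (suc j) zero j+0≡k with refl ← ℕ.suc-injective (trans (sym (ℕ.+-identityʳ (suc j))) j+0≡k) = defect-top j n
    defect-vanishes k n (suc j) (suc r) j+r≡k = trans (defect-middle k j r j<k n) (T-⊛-below n)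
      where
      j<k : suc j ≤ k
      j<k = subst (suc j ≤_) (ℕ.suc-injective (trans (sym (ℕ.+-suc (suc j) r)) j+r≡k)) (ℕ.m≤m+n (suc j) r)
      T-⊛-below : ∀ n → (T ⊛ (defect k j (suc (suc r)) ⊕ defect k (suc (suc j)) r)) n ≡ 0ℤ
      T-⊛-below zero    = refl
      T-⊛-below (suc n) = trans (T-⊛-suc _ n) (cong₂ ℤ._+_
        (defect-vanishes k n j (suc (suc r)) (trans (ℕ.+-suc j (suc r)) j+r≡k))
        (defect-vanishes k n (suc (suc j)) r (trans (cong suc (sym (ℕ.+-suc j r))) j+r≡k)))

  G-closed-form : ∀ k j r → j ℕ.+ r ≡ suc k → F (suc (suc k)) ⊛ G k j ≈ T ^ j ⊛ F r
  G-closed-form k j r j+r≡k n = ℤ.i-j≡0⇒i≡j _ _ (defect-vanishes k n j r j+r≡k)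

  F-cassini : ∀ j n → F (suc (n ℕ.+ j)) ⊛ F (suc n) ⊕ ⊝ (F (suc (suc (n ℕ.+ j))) ⊛ F n) ≈ X ^ n ⊛ F (suc j)
  F-cassini j zero n = begin
    (F (suc j) ⊛ 1S) n ℤ.+ ℤ.- (F (suc (suc j)) ⊛ 0S) n
      ≡⟨ cong₂ (λ u v → u ℤ.+ ℤ.- v) (≈-trans (⊛-comm (F (suc j)) 1S) (⊛-identityˡ (F (suc j))) n)
                                     (≈-trans (⊛-comm (F (suc (suc j))) 0S) (⊛-annihilˡ _ ≈-refl) n) ⟩
    F (suc j) n ℤ.+ 0ℤ  ≡⟨ ℤ.+-identityʳ (F (suc j) n) ⟩
    F (suc j) n         ≡⟨ ⊛-identityˡ (F (suc j)) n ⟨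
    (1S ⊛ F (suc j)) n  ∎
    where open ≡-Reasoning
  F-cassini j (suc n) = linear-combination (_ · F-cassini j n)
    (solve 7 (λ a b c d t xⁿ f →
       (b :* (c :- t :* t :* d) :- (b :- t :* t :* a) :* c) :- (t :* t :* xⁿ) :* f
         := t :* t :* ((a :* c :- b :* d) :- xⁿ :* f))
     ≈-refl (F (suc (n ℕ.+ j))) (F (suc (suc (n ℕ.+ j)))) (F (suc n)) (F n) T (X ^ n) (F (suc j)))

  H⊕G : ∀ k j → H (suc k) j ⊕ G k j ≈ G (suc k) j
  H⊕G k j n = cong +_ (Hc+Gc k j n)

  H-closed-form : ∀ k j n → n ℕ.+ j ≡ suc k →
    F (suc (suc k)) ⊛ F (suc (suc (suc k))) ⊛ H (suc k) j ≈ T ^ j ⊛ X ^ n ⊛ F (suc j)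
  H-closed-form k j n n+j≡k = linear-combination
    (  _ · H⊕G k j
    ⊞ _ · G-closed-form (suc k) j (suc n) (trans (ℕ.+-suc j n) (cong suc (trans (ℕ.+-comm j n) n+j≡k)))
    ⊞ _ · G-closed-form k j n (trans (ℕ.+-comm j n) n+j≡k)
    ⊞ _ · subst (λ m → F (suc m) ⊛ F (suc n) ⊕ ⊝ (F (suc (suc m)) ⊛ F n) ≈ X ^ n ⊛ F (suc j)) n+j≡k (F-cassini j n))
    (solve 10 (λ f₁ f₂ h g g′ tʲ fₙ₁ fₙ xⁿ fⱼ →
       f₁ :* f₂ :* h :- tʲ :* xⁿ :* fⱼ
         := f₁ :* f₂ :* ((h :+ g′) :- g)
          :+ (f₁ :* (f₂ :* g :- tʲ :* fₙ₁)
          :+ ((:- f₂) :* (f₁ :* g′ :- tʲ :* fₙ)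
          :+ tʲ :* ((f₁ :* fₙ₁ :- f₂ :* fₙ) :- xⁿ :* fⱼ))))
     ≈-refl (F (suc (suc k))) (F (suc (suc (suc k)))) (H (suc k) j) (G (suc k) j) (G k j) (T ^ j) (F (suc n)) (F n) (X ^ n) (F (suc j)))

module CatalanSubstitution where

  open PowerSeries
  open LinearCombination seriesRing using (linear-combination; _·_; _⊞_)
  open BallotNumbers using (ballot; Gc-stable)
  open ClosedForms
  open import Data.Integer as ℤ using (ℤ; +_; 1ℤ)
  import Data.Integer.Properties as ℤ
  open import Data.Nat as ℕ using (ℕ; zero; suc)
  import Data.Nat.Properties as ℕ
  open import Relation.Binary.PropositionalEquality

  Cat : Series
  Cat n = + ballot n 0

  F-constant-term : ∀ m → F (suc m) 0 ≡ 1ℤ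
  F-constant-term zero          = refl
  F-constant-term (suc zero)    = refl
  F-constant-term (suc (suc m)) = cong (ℤ._+ ℤ.- (X ⊛ F (suc m)) 0) (F-constant-term (suc m))

  G-suc-recursion : ∀ k → X ⊛ G k 0 ⊛ G (suc k) 0 ≈ G (suc k) 0 ⊕ ⊝ 1S
  G-suc-recursion k = unit-cancelˡ (F-constant-term (suc (suc k))) (linear-combination
    (_ · G-closed-form (suc k) 0 (suc (suc k)) refl ⊞ _ · G-closed-form k 0 (suc k) refl)
    (solve 5 (λ f₂ f₁ t g g′ →
       let f₃ = f₂ :- t :* t :* f₁ in
       f₃ :* (t :* t :* g :* g′) :- f₃ :* (g′ :- con (+ 1))
         := (t :* t :* g :- con (+ 1)) :* (f₃ :* g′ :- con (+ 1) :* f₂) :+ t :* t :* (f₂ :* g :- con (+ 1) :* f₁))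
     ≈-refl (F (suc (suc k))) (F (suc k)) T (G k 0) (G (suc k) 0)))

  G-agrees-with-Cat : ∀ k → G k 0 ≈[< suc k ] Cat
  G-agrees-with-Cat k i i<k = cong +_ (Gc-stable 0 (ℕ.≤-pred i<k))

  -- Below order n + 1, Cat agrees with both G n 0 and G (suc n) 0.
  catalan-equation : X ⊛ Cat ⊛ Cat ≈ Cat ⊕ ⊝ 1S
  catalan-equation n = begin
    (X ⊛ Cat ⊛ Cat) n
      ≡⟨ ⊛-cong-< (suc n) (⊛-cong-< (suc n) (λ _ _ → refl) (λ i i<n → sym (G-agrees-with-Cat n i i<n)))
                          (λ i i<n → sym (G-agrees-with-Cat (suc n) i (ℕ.m<n⇒m<1+n i<n))) n ℕ.≤-refl ⟩
    (X ⊛ G n 0 ⊛ G (suc n) 0) n ≡⟨ G-suc-recursion n n ⟩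
    G (suc n) 0 n ℤ.+ ℤ.- 1S n  ≡⟨ cong (ℤ._+ ℤ.- 1S n) (G-agrees-with-Cat (suc n) n (ℕ.m<n⇒m<1+n (ℕ.n<1+n n))) ⟩
    Cat n ℤ.+ ℤ.- 1S n          ∎
    where open ≡-Reasoning

  q : Series
  q = Cat ⊕ ⊝ 1S

  -- Cat written in terms of q, the form in which the ring solver sees it (Cat≈C).
  C : Series
  C = 1S ⊕ q

  U : ℕ → Series
  U m = 1S ⊕ ⊝ q ^ m

  Cat≈C : Cat ≈ C
  Cat≈C = solve 1 (λ c → c := con (+ 1) :+ (c :- con (+ 1))) ≈-refl Cat

  X-in-q : X ⊛ C ⊛ C ≈ q
  X-in-q = linear-combination (_ · catalan-equation)
    (solve 2 (λ c t → let c′ = con (+ 1) :+ (c :- con (+ 1)) in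
       t :* t :* c′ :* c′ :- (c :- con (+ 1)) := con (+ 1) :* (t :* t :* c :* c :- (c :- con (+ 1))))
     ≈-refl Cat T)

  X^-in-q : ∀ n → X ^ n ⊛ C ^ n ⊛ C ^ n ≈ q ^ n
  X^-in-q zero    = solve 0 (con (+ 1) :* con (+ 1) :* con (+ 1) := con (+ 1)) ≈-refl
  X^-in-q (suc n) = linear-combination (_ · X-in-q ⊞ _ · X^-in-q n)
    (solve 6 (λ t c q xⁿ cⁿ qⁿ →
       (t :* t :* xⁿ) :* (c :* cⁿ) :* (c :* cⁿ) :- q :* qⁿ
         := (xⁿ :* cⁿ :* cⁿ) :* (t :* t :* c :* c :- q) :+ q :* (xⁿ :* cⁿ :* cⁿ :- qⁿ))
     ≈-refl T C q (X ^ n) (C ^ n) (q ^ n))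

  F-in-q : ∀ i → F (suc i) ⊛ (1S ⊕ ⊝ q) ⊛ C ^ i ≈ U (suc i)
  F-in-q zero          = solve 1 (λ q → con (+ 1) :* (con (+ 1) :- q) :* con (+ 1) := con (+ 1) :- q :* con (+ 1)) ≈-refl q
  F-in-q (suc zero)    = linear-combination (_ · F-two)
    (solve 2 (λ f q → f :* (con (+ 1) :- q) :* ((con (+ 1) :+ q) :* con (+ 1)) :- (con (+ 1) :- q :* (q :* con (+ 1)))
                    := ((con (+ 1) :- q) :* ((con (+ 1) :+ q) :* con (+ 1))) :* (f :- con (+ 1)))
     ≈-refl (F 2) q)
    where
    F-two : F 2 ≈ 1S
    F-two n = trans (cong (λ v → 1S n ℤ.+ ℤ.- v) (≈-trans (⊛-comm X 0S) (⊛-annihilˡ X ≈-refl) n)) (ℤ.+-identityʳ (1S n))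
  F-in-q (suc (suc i)) = linear-combination (_ · F-in-q (suc i) ⊞ _ · F-in-q i ⊞ _ · X-in-q)
    (solve 6 (λ f₂ f₁ t q cⁱ qⁱ →
       let c = con (+ 1) :+ q in
       (f₂ :- t :* t :* f₁) :* (con (+ 1) :- q) :* (c :* (c :* cⁱ)) :- (con (+ 1) :- q :* (q :* (q :* qⁱ)))
         := c :* (f₂ :* (con (+ 1) :- q) :* (c :* cⁱ) :- (con (+ 1) :- q :* (q :* qⁱ)))
            :+ ((:- q) :* (f₁ :* (con (+ 1) :- q) :* cⁱ :- (con (+ 1) :- q :* qⁱ))
            :+ (:- (f₁ :* (con (+ 1) :- q) :* cⁱ)) :* (t :* t :* c :* c :- q)))
     ≈-refl (F (suc (suc i))) (F (suc i)) T q (C ^ i) (q ^ i))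

  G-in-q : ∀ k → U (suc (suc k)) ⊛ G k 0 ≈ C ⊛ U (suc k)
  G-in-q k = linear-combination (_ · F-in-q (suc k) ⊞ _ · G-closed-form k 0 (suc k) refl ⊞ _ · F-in-q k)
    (solve 6 (λ f₂ f₁ g q cᵏ qᵏ →
       let c = con (+ 1) :+ q in
       (con (+ 1) :- q :* (q :* qᵏ)) :* g :- c :* (con (+ 1) :- q :* qᵏ)
         := (:- g) :* (f₂ :* (con (+ 1) :- q) :* (c :* cᵏ) :- (con (+ 1) :- q :* (q :* qᵏ)))
            :+ (((con (+ 1) :- q) :* (c :* cᵏ)) :* (f₂ :* g :- con (+ 1) :* f₁)
            :+ c :* (f₁ :* (con (+ 1) :- q) :* cᵏ :- (con (+ 1) :- q :* qᵏ))))
     ≈-refl (F (suc (suc k))) (F (suc k)) (G k 0) q (C ^ k) (q ^ k))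

  -- Multiply the closed form of H by (1 - q)² C^(2k+3) and substitute.
  H-in-q : ∀ k j n → n ℕ.+ j ≡ suc k →
    U (suc (suc k)) ⊛ U (suc (suc (suc k))) ⊛ H (suc k) j ≈ q ^ n ⊛ (1S ⊕ ⊝ q) ⊛ U (suc j) ⊛ T ^ j ⊛ C ^ j ⊛ C
  H-in-q k j n n+j≡k = linear-combination
    (  _ · F-in-q (suc k) ⊞ _ · F-in-q (suc (suc k)) ⊞ _ · H-closed-form k j n n+j≡k
    ⊞ _ · X^-in-q n ⊞ _ · F-in-q j ⊞ _ · ≈-trans (≈-reflexive (cong (C ^_) (sym n+j≡k))) (^-+ C n j))
    (solve 13 (λ f₂ f₃ h q Q c₁ cⁿ cʲ tʲ xⁿ fⱼ qʲ qⁿ →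
       let c = con (+ 1) :+ q
           p = con (+ 1) :- q in
       (con (+ 1) :- q :* Q) :* (con (+ 1) :- q :* (q :* Q)) :* h :- qⁿ :* p :* (con (+ 1) :- q :* qʲ) :* tʲ :* cʲ :* c
         := (:- ((con (+ 1) :- q :* (q :* Q)) :* h)) :* (f₂ :* p :* c₁ :- (con (+ 1) :- q :* Q))
            :+ ((:- (f₂ :* p :* c₁ :* h)) :* (f₃ :* p :* (c :* c₁) :- (con (+ 1) :- q :* (q :* Q)))
            :+ ((p :* p :* c :* c₁ :* c₁) :* (f₂ :* f₃ :* h :- tʲ :* xⁿ :* fⱼ)
            :+ ((tʲ :* fⱼ :* p :* p :* c :* cʲ :* cʲ) :* (xⁿ :* cⁿ :* cⁿ :- qⁿ)
            :+ ((tʲ :* qⁿ :* p :* c :* cʲ) :* (fⱼ :* p :* cʲ :- (con (+ 1) :- q :* qʲ))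
            :+ (tʲ :* xⁿ :* fⱼ :* p :* p :* c :* (c₁ :+ cⁿ :* cʲ)) :* (c₁ :- cⁿ :* cʲ))))))
     ≈-refl (F (suc (suc k))) (F (suc (suc (suc k)))) (H (suc k) j) q (q ^ suc k) (C ^ suc k) (C ^ n) (C ^ j)
            (T ^ j) (X ^ n) (F (suc j)) (q ^ j) (q ^ n))

module Telescoping where

  open PowerSeries
  open LinearCombination seriesRing using (linear-combination; _·_; _⊞_)
  open ClosedForms
  open CatalanSubstitution
  open import Data.Integer as ℤ using (ℤ; +_)
  import Data.Integer.Properties as ℤ
  open import Data.Nat as ℕ using (ℕ; zero; suc; s<s)
  import Data.Nat.Properties as ℕ
  open import Relation.Binary.PropositionalEquality

  term : ℕ → Series
  term i = T ⊛ (H (6 ℕ.+ i) 4 ⊛ (H (4 ℕ.+ i) 3 ⊛ H (2 ℕ.+ i) 2))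

  K : Series
  K = (1S ⊕ ⊝ q) ^ 3 ⊛ C ^ 2 ⊛ (U 3 ⊛ U 4 ⊛ U 5)

  term-in-q : ∀ i → U (3 ℕ.+ i) ⊛ U (4 ℕ.+ i) ⊛ U (5 ℕ.+ i) ⊛ U (6 ℕ.+ i) ⊛ U (7 ℕ.+ i) ⊛ U (8 ℕ.+ i) ⊛ term i
                    ≈ K ⊛ q ^ 8 ⊛ (q ^ i) ^ 3
  term-in-q i = linear-combination
    (  _ · H-in-q (5 ℕ.+ i) 4 (2 ℕ.+ i) (cong (λ m → suc (suc m)) (ℕ.+-comm i 4))
    ⊞ _ · H-in-q (3 ℕ.+ i) 3 (1 ℕ.+ i) (cong suc (ℕ.+-comm i 3))
    ⊞ _ · H-in-q (1 ℕ.+ i) 2 i (ℕ.+-comm i 2)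
    ⊞ _ · X^-in-q 5)
    (solve 15 (λ q w t h₆ h₄ h₂ u₃ u₄ u₅ v₃ v₄ v₅ v₆ v₇ v₈ →
       let c = con (+ 1) :+ q
           p = con (+ 1) :- q
           A₆ = v₇ :* v₈ :* h₆
           A₄ = v₅ :* v₆ :* h₄
           A₂ = v₃ :* v₄ :* h₂
           B₆ = q :* (q :* w) :* p :* u₅ :* t :^ 4 :* c :^ 4 :* c
           B₄ = q :* w :* p :* u₄ :* t :^ 3 :* c :^ 3 :* c
           B₂ = w :* p :* u₃ :* t :^ 2 :* c :^ 2 :* c
       in v₃ :* v₄ :* v₅ :* v₆ :* v₇ :* v₈ :* (t :* (h₆ :* (h₄ :* h₂))) :- p :^ 3 :* c :^ 2 :* (u₃ :* u₄ :* u₅) :* q :^ 8 :* w :^ 3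
          := (t :* A₄ :* A₂) :* (A₆ :- B₆)
             :+ ((t :* B₆ :* A₂) :* (A₄ :- B₄)
             :+ ((t :* B₆ :* B₄) :* (A₂ :- B₂)
             :+ (w :^ 3 :* q :^ 3 :* p :^ 3 :* u₃ :* u₄ :* u₅ :* c :^ 2) :* ((t :* t) :^ 5 :* c :^ 5 :* c :^ 5 :- q :^ 5))))
     ≈-refl q (q ^ i) T (H (6 ℕ.+ i) 4) (H (4 ℕ.+ i) 3) (H (2 ℕ.+ i) 2) (U 3) (U 4) (U 5)
            (U (3 ℕ.+ i)) (U (4 ℕ.+ i)) (U (5 ℕ.+ i)) (U (6 ℕ.+ i)) (U (7 ℕ.+ i)) (U (8 ℕ.+ i)))

  -- The tail Σ_{l ≥ i} term l equals K ⊛ R (q ^ i) / D i.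
  R : Series → Series
  R w = q ^ 8 ⊛ w ^ 3 ⊛ (U 4 ⊛ U 5 ⊕ ⊝ (q ^ 6 ⊛ U 2 ⊛ U 5 ⊛ w) ⊕ q ^ 13 ⊛ U 1 ⊛ U 2 ⊛ w ⊛ w)

  D : ℕ → Series
  D i = U 3 ⊛ U 4 ⊛ U 5 ⊛ (U (3 ℕ.+ i) ⊛ U (4 ℕ.+ i) ⊛ U (5 ℕ.+ i) ⊛ U (6 ℕ.+ i) ⊛ U (7 ℕ.+ i))

  R-telescopes : ∀ i → R (q ^ i) ⊛ U (8 ℕ.+ i) ⊕ ⊝ (R (q ^ suc i) ⊛ U (3 ℕ.+ i)) ≈ U 3 ⊛ U 4 ⊛ U 5 ⊛ q ^ 8 ⊛ (q ^ i) ^ 3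
  R-telescopes i = solve 2 (λ q w →
    let U = λ m → con (+ 1) :- q :^ m
        R = λ w → q :^ 8 :* w :^ 3 :* (U 4 :* U 5 :- q :^ 6 :* U 2 :* U 5 :* w :+ q :^ 13 :* U 1 :* U 2 :* w :* w)
    in R w :* (con (+ 1) :- q^[ 8 ] q w) :- R (q :* w) :* (con (+ 1) :- q^[ 3 ] q w) := U 3 :* U 4 :* U 5 :* q :^ 8 :* w :^ 3)
    ≈-refl q (q ^ i)
    where
    -- q ⊛ (q ⊛ … ⊛ w), the shape into which U (m + i) unfolds; q :^ m :* w would not match it.
    q^[_] : ∀ {v} → ℕ → Polynomial v → Polynomial v → Polynomial v
    q^[ zero  ] q w = w
    q^[ suc m ] q w = q :* q^[ m ] q w

  tail-step : ∀ i → K ⊛ R (q ^ i) ⊛ D (suc i) ⊕ ⊝ (K ⊛ R (q ^ suc i) ⊛ D i) ≈ D i ⊛ D (suc i) ⊛ term i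
  tail-step i = linear-combination (_ · R-telescopes i ⊞ _ · term-in-q i)
    (solve 13 (λ k a r₀ r₁ τ v₃ v₄ v₅ v₆ v₇ v₈ q⁸ w³ →
       let D₀ = a :* (v₃ :* v₄ :* v₅ :* v₆ :* v₇)
           D₁ = a :* (v₄ :* v₅ :* v₆ :* v₇ :* v₈)
       in k :* r₀ :* D₁ :- k :* r₁ :* D₀ :- D₀ :* D₁ :* τ
          := (k :* a :* v₄ :* v₅ :* v₆ :* v₇) :* (r₀ :* v₈ :- r₁ :* v₃ :- a :* q⁸ :* w³)
             :+ (:- (a :* a :* v₄ :* v₅ :* v₆ :* v₇)) :* (v₃ :* v₄ :* v₅ :* v₆ :* v₇ :* v₈ :* τ :- k :* q⁸ :* w³))
     ≈-refl K (U 3 ⊛ U 4 ⊛ U 5) (R (q ^ i)) (R (q ^ suc i)) (term i)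
            (U (3 ℕ.+ i)) (U (4 ℕ.+ i)) (U (5 ℕ.+ i)) (U (6 ℕ.+ i)) (U (7 ℕ.+ i)) (U (8 ℕ.+ i)) (q ^ 8) ((q ^ i) ^ 3))

  catalanQuartic : Series
  catalanQuartic = 1S ⊕ const (+ 10) ⊛ Cat ⊛ Cat ⊕ ⊝ (const (+ 6) ⊛ Cat ⊛ Cat ⊛ Cat) ⊕ Cat ⊛ Cat ⊛ Cat ⊛ Cat

  gSum : Series
  gSum = const (+ 2) ⊛ G 1 0 ⊕ const (+ 2) ⊛ G 2 0 ⊕ G 3 0 ⊕ G 5 0

  sum-closed-form : D 0 ⊛ (catalanQuartic ⊕ ⊝ gSum) ≈ K ⊛ R 1S
  sum-closed-form = linear-combination (_ · Cat≈C ⊞ _ · G-in-q 1 ⊞ _ · G-in-q 2 ⊞ _ · G-in-q 3 ⊞ _ · G-in-q 5)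
    (solve 7 (λ q a cat g₁ g₂ g₃ g₅ →
       let U = λ m → con (+ 1) :- q :^ m
           c = con (+ 1) :+ q
           p = con (+ 1) :- q
           D₀ = a :* (U 3 :* U 4 :* U 5 :* U 6 :* U 7)
           Y = λ x → con (+ 1) :+ con (+ 10) :* x :* x :- con (+ 6) :* x :* x :* x :+ x :* x :* x :* x
           Y′ = con (+ 10) :* (cat :+ c) :- con (+ 6) :* (cat :* cat :+ cat :* c :+ c :* c)
                :+ (cat :* cat :* cat :+ cat :* cat :* c :+ cat :* c :* c :+ c :* c :* c)
           R₁ = q :^ 8 :* con (+ 1) :^ 3 :* (U 4 :* U 5 :- q :^ 6 :* U 2 :* U 5 :* con (+ 1) :+ q :^ 13 :* U 1 :* U 2 :* con (+ 1) :* con (+ 1))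
       in D₀ :* (Y cat :- (con (+ 2) :* g₁ :+ con (+ 2) :* g₂ :+ g₃ :+ g₅)) :- p :^ 3 :* c :^ 2 :* a :* R₁
          := (D₀ :* Y′) :* (cat :- c)
             :+ ((:- (con (+ 2) :* a :* U 4 :* U 5 :* U 6 :* U 7)) :* (U 3 :* g₁ :- c :* U 2)
             :+ ((:- (con (+ 2) :* a :* U 3 :* U 5 :* U 6 :* U 7)) :* (U 4 :* g₂ :- c :* U 3)
             :+ ((:- (a :* U 3 :* U 4 :* U 6 :* U 7)) :* (U 5 :* g₃ :- c :* U 4)
             :+ (:- (a :* U 3 :* U 4 :* U 5 :* U 6)) :* (U 7 :* g₅ :- c :* U 6)))))
     ≈-refl q (U 3 ⊛ U 4 ⊛ U 5) Cat (G 1 0) (G 2 0) (G 3 0) (G 5 0))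

  partialSum : ℕ → Series
  partialSum zero    = 0S
  partialSum (suc i) = partialSum i ⊕ term i

  tail-closed-form : ∀ i → D i ⊛ (catalanQuartic ⊕ ⊝ gSum ⊕ ⊝ partialSum i) ≈ K ⊛ R (q ^ i)
  tail-closed-form zero    = ≈-trans (⊛-cong {D 0} ≈-refl (λ n → ℤ.+-identityʳ _)) sum-closed-form
  tail-closed-form (suc i) = unit-cancelˡ {D i} refl (linear-combination (_ · tail-closed-form i ⊞ _ · tail-step i)
    (solve 8 (λ d₀ d₁ z s τ k r₀ r₁ →
       d₀ :* (d₁ :* (z :- (s :+ τ))) :- d₀ :* (k :* r₁)
         := d₁ :* (d₀ :* (z :- s) :- k :* r₀) :+ con (+ 1) :* ((k :* r₀ :* d₁ :- k :* r₁ :* d₀) :- d₀ :* d₁ :* τ))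
     ≈-refl (D i) (D (suc i)) (catalanQuartic ⊕ ⊝ gSum) (partialSum i) (term i) K (R (q ^ i)) (R (q ^ suc i))))

  q-order : q ≈[< 1 ] 0S
  q-order zero    _         = refl
  q-order (suc n) (s<s ())

  q^-order : ∀ i → q ^ i ≈[< i ] 0S
  q^-order zero    n ()
  q^-order (suc i) = ⊛-order 1 i q-order (q^-order i)

  tail-order : ∀ i → K ⊛ R (q ^ i) ≈[< suc i ] 0S
  tail-order i = ⊛-orderʳ K (suc i)
    (⊛-orderˡ _ (suc i) (⊛-order 1 i (⊛-orderˡ (q ^ 7) 1 q-order) (⊛-orderˡ ((q ^ i) ^ 2) i (q^-order i))))

  partialSum-exact : ∀ i → (catalanQuartic ⊕ ⊝ gSum) i ≡ partialSum i i
  partialSum-exact i = ℤ.i-j≡0⇒i≡j _ _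
    (unit-⊛-order {D i} (suc i) refl (λ n n<i → trans (tail-closed-form i n) (tail-order i n n<i)) i ℕ.≤-refl)

module Coefficients where

  open PowerSeries
  open LinearCombination seriesRing using (linear-combination; _·_)
  open ClosedForms using (H)
  open CatalanSubstitution using (Cat; catalan-equation)
  open Telescoping
  open import Data.Integer as ℤ using (ℤ; +_; 0ℤ)
  import Data.Integer.Properties as ℤ
  open import Data.Integer.Tactic.RingSolver using () renaming (solve-∀ to ℤ-solve-∀)
  open import Data.Nat as ℕ using (ℕ; zero; suc; _∸_)
  import Data.Nat.Properties as ℕ
  open import Relation.Binary.PropositionalEquality
  open ≡-Reasoning

  X-⊛-suc-suc : ∀ a n → (X ⊛ a) (suc (suc n)) ≡ a n
  X-⊛-suc-suc a n = begin
    (T ⊛ T ⊛ a) (suc (suc n))   ≡⟨ ⊛-assoc T T a (suc (suc n)) ⟩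
    (T ⊛ (T ⊛ a)) (suc (suc n)) ≡⟨ T-⊛-suc (T ⊛ a) (suc n) ⟩
    (T ⊛ a) (suc n)             ≡⟨ T-⊛-suc a n ⟩
    a n                         ∎

  -- Eliminating x with x C² = C - 1 leaves x³ Y = 16 x² C - 8 x C + C + (x³ - 10 x² + 7 x - 1).
  quartic-shift : X ⊛ (X ⊛ (X ⊛ catalanQuartic))
                  ≈ X ⊛ (X ⊛ (const (+ 16) ⊛ Cat) ⊕ ⊝ (const (+ 8) ⊛ Cat) ⊕ X ⊛ (X ⊛ 1S ⊕ ⊝ const (+ 10)) ⊕ const (+ 7))
                    ⊕ Cat ⊕ ⊝ 1S
  quartic-shift = linear-combination (_ · catalan-equation)
    (solve 2 (λ t c →
       let x = t :* t in
       x :* (x :* (x :* (con (+ 1) :+ con (+ 10) :* c :* c :- con (+ 6) :* c :* c :* c :+ c :* c :* c :* c)))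
         :- (x :* (x :* (con (+ 16) :* c) :- con (+ 8) :* c :+ x :* (x :* con (+ 1) :- con (+ 10)) :+ con (+ 7)) :+ c :- con (+ 1))
         := (x :* x :* c :* c :+ (x :- con (+ 6) :* x :* x) :* c :+ con (+ 10) :* x :* x :- con (+ 7) :* x :+ con (+ 1))
              :* (x :* c :* c :- (c :- con (+ 1))))
     ≈-refl T Cat)

  quartic-coefficient : ∀ j → catalanQuartic (suc j) ≡ + 16 ℤ.* Cat (3 ℕ.+ j) ℤ.- + 8 ℤ.* Cat (5 ℕ.+ j) ℤ.+ Cat (7 ℕ.+ j)
  quartic-coefficient j = begin
    catalanQuartic (suc j)                      ≡⟨ X³-shift ⟨
    (X ⊛ (X ⊛ (X ⊛ catalanQuartic))) (7 ℕ.+ j) ≡⟨ quartic-shift (7 ℕ.+ j) ⟩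
    (X ⊛ E) (7 ℕ.+ j) ℤ.+ c ℤ.+ ℤ.- 0ℤ          ≡⟨ cong (λ v → v ℤ.+ c ℤ.+ ℤ.- 0ℤ) (X-⊛-suc-suc E (5 ℕ.+ j)) ⟩
    E (5 ℕ.+ j) ℤ.+ c ℤ.+ ℤ.- 0ℤ                ≡⟨ collect sixteen eight lower ⟩
    + 16 ℤ.* a ℤ.- + 8 ℤ.* b ℤ.+ c              ∎
    where
    a = Cat (3 ℕ.+ j)
    b = Cat (5 ℕ.+ j)
    c = Cat (7 ℕ.+ j)
    poly E : Series
    poly = X ⊛ 1S ⊕ ⊝ const (+ 10)
    E    = X ⊛ (const (+ 16) ⊛ Cat) ⊕ ⊝ (const (+ 8) ⊛ Cat) ⊕ X ⊛ poly ⊕ const (+ 7)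
    X³-shift : (X ⊛ (X ⊛ (X ⊛ catalanQuartic))) (7 ℕ.+ j) ≡ catalanQuartic (suc j)
    X³-shift = trans (X-⊛-suc-suc (X ⊛ (X ⊛ catalanQuartic)) (5 ℕ.+ j))
                 (trans (X-⊛-suc-suc (X ⊛ catalanQuartic) (3 ℕ.+ j)) (X-⊛-suc-suc catalanQuartic (1 ℕ.+ j)))
    sixteen : (X ⊛ (const (+ 16) ⊛ Cat)) (5 ℕ.+ j) ≡ + 16 ℤ.* a
    sixteen = trans (X-⊛-suc-suc (const (+ 16) ⊛ Cat) (3 ℕ.+ j)) (const-⊛ (+ 16) Cat (3 ℕ.+ j))
    eight : (const (+ 8) ⊛ Cat) (5 ℕ.+ j) ≡ + 8 ℤ.* b
    eight = const-⊛ (+ 8) Cat (5 ℕ.+ j)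
    lower : (X ⊛ poly) (5 ℕ.+ j) ≡ 0ℤ
    lower = trans (X-⊛-suc-suc poly (3 ℕ.+ j)) (cong (ℤ._+ ℤ.- 0ℤ) (X-⊛-suc-suc 1S (1 ℕ.+ j)))
    tidy : ∀ a b c → + 16 ℤ.* a ℤ.+ ℤ.- (+ 8 ℤ.* b) ℤ.+ 0ℤ ℤ.+ 0ℤ ℤ.+ c ℤ.+ ℤ.- 0ℤ ≡ + 16 ℤ.* a ℤ.- + 8 ℤ.* b ℤ.+ c
    tidy = ℤ-solve-∀
    collect : ∀ {u v w} → u ≡ + 16 ℤ.* a → v ≡ + 8 ℤ.* b → w ≡ 0ℤ →
              u ℤ.+ ℤ.- v ℤ.+ w ℤ.+ 0ℤ ℤ.+ c ℤ.+ ℤ.- 0ℤ ≡ + 16 ℤ.* a ℤ.- + 8 ℤ.* b ℤ.+ c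
    collect refl refl refl = tidy a b c

  sumTo-cong : ∀ n {f g : ℕ → ℕ} → (∀ i → f i ≡ g i) → sumTo n f ≡ sumTo n g
  sumTo-cong zero    f≗g = f≗g 0
  sumTo-cong (suc n) f≗g = cong₂ ℕ._+_ (sumTo-cong n f≗g) (f≗g (suc n))

  sumTo-*ˡ : ∀ n x (f : ℕ → ℕ) → x ℕ.* sumTo n f ≡ sumTo n (λ i → x ℕ.* f i)
  sumTo-*ˡ zero    x f = refl
  sumTo-*ˡ (suc n) x f = trans (ℕ.*-distribˡ-+ x (sumTo n f) (f (suc n))) (cong (ℕ._+ x ℕ.* f (suc n)) (sumTo-*ˡ n x f))

  sumTo-suc : ∀ n (f : ℕ → ℕ) → sumTo (suc n) f ≡ f 0 ℕ.+ sumTo n (λ i → f (suc i))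
  sumTo-suc zero    f = refl
  sumTo-suc (suc n) f = trans (cong (ℕ._+ f (suc (suc n))) (sumTo-suc n f)) (ℕ.+-assoc (f 0) _ (f (suc (suc n))))

  ⊛-natural : ∀ {a b} (f g : ℕ → ℕ) → (∀ n → a n ≡ + f n) → (∀ n → b n ≡ + g n) →
    ∀ n → (a ⊛ b) n ≡ + sumTo n (λ l → f l ℕ.* g (n ∸ l))
  ⊛-natural f g a≡f b≡g zero    = trans (cong₂ ℤ._*_ (a≡f 0) (b≡g 0)) (sym (ℤ.pos-* (f 0) (g 0)))
  ⊛-natural {a} {b} f g a≡f b≡g (suc n) = begin
    a 0 ℤ.* b (suc n) ℤ.+ (tail a ⊛ b) n                    ≡⟨ cong₂ ℤ._+_ (cong₂ ℤ._*_ (a≡f 0) (b≡g (suc n)))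
                                                                           (⊛-natural (λ l → f (suc l)) g (λ l → a≡f (suc l)) b≡g n) ⟩
    + f 0 ℤ.* + g (suc n) ℤ.+ + sumTo n (λ l → f (suc l) ℕ.* g (n ∸ l))
                                                            ≡⟨ cong (ℤ._+ + sumTo n (λ l → f (suc l) ℕ.* g (n ∸ l))) (ℤ.pos-* (f 0) (g (suc n))) ⟨
    + (f 0 ℕ.* g (suc n) ℕ.+ sumTo n (λ l → f (suc l) ℕ.* g (n ∸ l)))
                                                            ≡⟨ cong +_ (sumTo-suc n (λ l → f l ℕ.* g (suc n ∸ l))) ⟨
    + sumTo (suc n) (λ l → f l ℕ.* g (suc n ∸ l))           ∎

  term-coefficient : ∀ i m → term i (suc m) ≡ + prodCoeff (6 ℕ.+ i) m
  term-coefficient i m = begin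
    term i (suc m)
      ≡⟨ T-⊛-suc _ m ⟩
    (H (6 ℕ.+ i) 4 ⊛ (H (4 ℕ.+ i) 3 ⊛ H (2 ℕ.+ i) 2)) m
      ≡⟨ ⊛-natural _ _ (λ _ → refl) (⊛-natural _ _ (λ _ → refl) (λ _ → refl)) m ⟩
    + sumTo m (λ a → h₄ a ℕ.* sumTo (m ∸ a) (λ b → h₃ b ℕ.* h₂ (m ∸ a ∸ b)))
      ≡⟨ cong +_ (sumTo-cong m λ a → trans (sumTo-*ˡ (m ∸ a) (h₄ a) (λ b → h₃ b ℕ.* h₂ (m ∸ a ∸ b)))
                                            (sumTo-cong (m ∸ a) λ b → sym (ℕ.*-assoc (h₄ a) (h₃ b) (h₂ (m ∸ a ∸ b))))) ⟩
    + prodCoeff (6 ℕ.+ i) m ∎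
    where
    h₄ h₃ h₂ : ℕ → ℕ
    h₄ = Hc (6 ℕ.+ i) 4
    h₃ = Hc (4 ℕ.+ i) 3
    h₂ = Hc (2 ℕ.+ i) 2

  partialSum-coefficient : ∀ m n → partialSum (suc m) (suc n) ≡ + sumTo m (λ i → prodCoeff (6 ℕ.+ i) n)
  partialSum-coefficient zero    n = trans (ℤ.+-identityˡ _) (term-coefficient 0 n)
  partialSum-coefficient (suc m) n = cong₂ ℤ._+_ (partialSum-coefficient m n) (term-coefficient (suc m) n)

module RightHandSide where

  open import Data.Nat using (ℕ; suc; _+_; _*_)

  open PowerSeries
  open BallotNumbers using (catalan)
  open ClosedForms using (G)
  open CatalanSubstitution using (Cat)
  open Telescoping
  open Coefficients
  open import Data.Integer as ℤ using (ℤ; +_)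
  import Data.Integer.Properties as ℤ
  open import Data.Integer.Tactic.RingSolver using () renaming (solve-∀ to ℤ-solve-∀)
  open import Data.Nat.Tactic.RingSolver using () renaming (solve-∀ to ℕ-solve-∀)
  open import Relation.Binary.PropositionalEquality using (_≡_; refl; cong; cong₂; sym; trans; module ≡-Reasoning)
  open ≡-Reasoning

  gSum-coefficient : ∀ n → gSum n ≡ + (2 * Gc 1 0 n + 2 * Gc 2 0 n + Gc 3 0 n + Gc 5 0 n)
  gSum-coefficient n = cong₂ (λ u v → u ℤ.+ v ℤ.+ + Gc 3 0 n ℤ.+ + Gc 5 0 n)
    (trans (const-⊛ (+ 2) (G 1 0) n) (sym (ℤ.pos-* 2 (Gc 1 0 n))))
    (trans (const-⊛ (+ 2) (G 2 0) n) (sym (ℤ.pos-* 2 (Gc 2 0 n))))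

  rhsCoeff-quartic : ∀ N → + rhsCoeff (suc N) ≡ catalanQuartic (suc (2 * N + 1))
  rhsCoeff-quartic N = begin
    + (sumCoeff m + gs (2 * suc N))             ≡⟨ cong (λ i → + (sumCoeff m + gs i)) (2[1+N]≡ N) ⟩
    + sumCoeff m ℤ.+ + gs (suc m)               ≡⟨ cong₂ ℤ._+_ (partialSum-coefficient m m) (gSum-coefficient (suc m)) ⟨
    partialSum (suc m) (suc m) ℤ.+ gSum (suc m) ≡⟨ cong (ℤ._+ gSum (suc m)) (partialSum-exact (suc m)) ⟨
    catalanQuartic (suc m) ℤ.- gSum (suc m) ℤ.+ gSum (suc m) ≡⟨ minus-plus (catalanQuartic (suc m)) (gSum (suc m)) ⟩
    catalanQuartic (suc m)                      ∎
    where
    m = 2 * N + 1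
    gs : ℕ → ℕ
    gs n = 2 * Gc 1 0 n + 2 * Gc 2 0 n + Gc 3 0 n + Gc 5 0 n
    2[1+N]≡ : ∀ N → 2 * suc N ≡ suc (2 * N + 1)
    2[1+N]≡ = ℕ-solve-∀
    minus-plus : ∀ a b → a ℤ.- b ℤ.+ b ≡ a
    minus-plus = ℤ-solve-∀

  Cat-double : ∀ {k} n → k ≡ n + n → Cat k ≡ + catalan n
  Cat-double n refl = refl

  quartic-catalan : ∀ N → catalanQuartic (suc (2 * N + 1)) ≡ + 16 ℤ.* + catalan (2 + N) ℤ.- + 8 ℤ.* + catalan (3 + N) ℤ.+ + catalan (4 + N)
  quartic-catalan N = begin
    catalanQuartic (suc m)                                          ≡⟨ quartic-coefficient m ⟩
    + 16 ℤ.* Cat (3 + m) ℤ.- + 8 ℤ.* Cat (5 + m) ℤ.+ Cat (7 + m)  ≡⟨ cong₂ (λ a b → + 16 ℤ.* a ℤ.- + 8 ℤ.* b ℤ.+ Cat (7 + m))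
                                                                           (Cat-double (2 + N) (3+m≡ N)) (Cat-double (3 + N) (5+m≡ N)) ⟩
    + 16 ℤ.* + catalan (2 + N) ℤ.- + 8 ℤ.* + catalan (3 + N) ℤ.+ Cat (7 + m)
                                                                    ≡⟨ cong (λ c → + 16 ℤ.* + catalan (2 + N) ℤ.- + 8 ℤ.* + catalan (3 + N) ℤ.+ c)
                                                                           (Cat-double (4 + N) (7+m≡ N)) ⟩
    + 16 ℤ.* + catalan (2 + N) ℤ.- + 8 ℤ.* + catalan (3 + N) ℤ.+ + catalan (4 + N) ∎
    where
    m = 2 * N + 1
    3+m≡ : ∀ N → 3 + (2 * N + 1) ≡ (2 + N) + (2 + N)
    3+m≡ = ℕ-solve-∀
    5+m≡ : ∀ N → 5 + (2 * N + 1) ≡ (3 + N) + (3 + N)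
    5+m≡ = ℕ-solve-∀
    7+m≡ : ∀ N → 7 + (2 * N + 1) ≡ (4 + N) + (4 + N)
    7+m≡ = ℕ-solve-∀

  rhsCoeff-suc : ∀ N → rhsCoeff (suc N) + 8 * catalan (3 + N) ≡ 16 * catalan (2 + N) + catalan (4 + N)
  rhsCoeff-suc N = ℤ.+-injective (begin
    + rhsCoeff (suc N) ℤ.+ + (8 * b)           ≡⟨ cong₂ ℤ._+_ (trans (rhsCoeff-quartic N) (quartic-catalan N)) (ℤ.pos-* 8 b) ⟩
    + 16 ℤ.* + a ℤ.- + 8 ℤ.* + b ℤ.+ + c ℤ.+ + 8 ℤ.* + b ≡⟨ cancel (+ a) (+ b) (+ c) ⟩
    + 16 ℤ.* + a ℤ.+ + c                       ≡⟨ cong (ℤ._+ + c) (ℤ.pos-* 16 a) ⟨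
    + (16 * a + c)                             ∎)
    where
    a = catalan (2 + N)
    b = catalan (3 + N)
    c = catalan (4 + N)
    cancel : ∀ a b c → + 16 ℤ.* a ℤ.- + 8 ℤ.* b ℤ.+ c ℤ.+ + 8 ℤ.* b ≡ + 16 ℤ.* a ℤ.+ c
    cancel = ℤ-solve-∀

open import Data.Nat using (ℕ; suc; _+_; _*_; _!)
open import Relation.Binary.PropositionalEquality using (_≡_; refl)
open BallotNumbers using (catalan-T₃)
open RightHandSide using (rhsCoeff-suc)

theorem4p2 : (N : ℕ) →
    rhsCoeff N * ((suc N) ! * (suc N + 3) !) ≡ δ0 N * ((suc N) ! * (suc N + 3) !) + 60 * (2 * suc N) !
theorem4p2 0       = refl
theorem4p2 (suc N) = catalan-T₃ (2 + N) (rhsCoeff (suc N)) (rhsCoeff-suc N)
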